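{- Let $n \geq 1$ and let $\mathcal F \subseteq 2^{[n]}$ be a simply rooted family of sets such that $\emptyset \in \mathcal F$. Then the cubical set $X(\mathcal F) \subseteq \mathbb R^n$ is acyclic.
   Context: $[n]=\{1,\dots,n\}$ and $2^{[n]}$ is its power set. For $A,B\in 2^{[n]}$, $[A,B]=\{C\in 2^{[n]}: A\subseteq C\subseteq B\}$, and $[i,B]$ means $[\{i\},B]$. A family $\mathcal F\subseteq 2^{[n]}$ is simply rooted if for every non-empty $A\in\mathcal F$ there is $i\in A$ with $[i,A]\subseteq\mathcal F$. The set of cubes of $\mathcal F$ is $\mathcal C(\mathcal F)=\{[A,B]: A\subseteq B,\ [A,B]\subseteq \mathcal F\}$. For $A\subseteq B\subseteq[n]$, the geometric realization $|[A,B]|=I_1\times\dots\times I_n\subseteq\mathbb R^n$ where $I_i=\{1\}$ if $i\in A$, $I_i=[0,1]$ if $i\in B\setminus A$, and $I_i=\{0\}$ if $i\notin B$. The geometric realization of $\mathcal F$ is the cubical set $X(\mathcal F)=\bigcup_{[A,B]\in\mathcal C(\mathcal F)}|[A,B]|$. A cubical set (finite union of elementary cubes, i.e. products of intervals $[a,b]$ with $a,b\in\mathbb Z$, $b-a\in\{0,1\}$) $X$ is acyclic if it is non-empty, connected, and its cubical homology groups $H_i(X)$ are trivial for all $i\geq 1$. -}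

module Defs where

open import Data.Nat using (ℕ; zero; suc; _≤_)
open import Data.Integer using (ℤ; +_; -_; _*_; _+_; 0ℤ; 1ℤ; -1ℤ)
import Data.Integer as ℤ
open import Data.Bool using (Bool; true; false)
import Data.Bool as B
open import Data.Vec using (Vec; []; _∷_; zipWith)
import Data.Vec.Properties as VecP
import Data.Product.Properties as ProdP
open import Data.Vec.Relation.Binary.Pointwise.Inductive using (Pointwise)
open import Data.List using (List; []; _∷_; map; concatMap; _++_)
open import Data.List.Relation.Unary.All using (All)
open import Data.Product using (Σ; ∃; ∃₂; _×_; _,_)
open import Relation.Binary.PropositionalEquality using (_≡_)
open import Relation.Binary.Definitions using (DecidableEquality)
open import Relation.Nullary using (yes; no)
open import Relation.Binary.Construct.Closure.ReflexiveTransitive using (Star)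
open import Data.Fin.Subset using (Subset; ⁅_⁆; _⊆_; Nonempty) renaming (⊥ to ∅; _∈_ to _∈ₛ_)

-- (a , false) is the degenerate interval [a] = [a,a];
-- (a , true)  is the nondegenerate interval [a, a+1].
Interval : Set
Interval = ℤ × Bool

Cube : ℕ → Set
Cube n = Vec Interval n

dimI : Interval → ℕ
dimI (_ , false) = 0
dimI (_ , true)  = 1

dim : ∀ {n} → Cube n → ℕ
dim []      = 0
dim (I ∷ Q) = dimI I Data.Nat.+ dim Q

data _⊑I_ : Interval → Interval → Set where
  same  : ∀ {I} → I ⊑I I
  left  : ∀ {a} → (a , false) ⊑I (a , true)
  right : ∀ {a b} → b ≡ a + 1ℤ → (b , false) ⊑I (a , true)

_⊑_ : ∀ {n} → Cube n → Cube n → Set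
_⊑_ = Pointwise _⊑I_

_≟I_ : DecidableEquality Interval
_≟I_ = ProdP.≡-dec ℤ._≟_ B._≟_

_≟C_ : ∀ {n} → DecidableEquality (Cube n)
_≟C_ = VecP.≡-dec _≟I_

-- A cubical set is represented by its set 𝒦(X) of elementary cubes
-- (those elementary cubes contained in X).

CubeSet : ℕ → Set₁
CubeSet n = Cube n → Set

Chain : ℕ → Set
Chain n = List (ℤ × Cube n)

coeff : ∀ {n} → Chain n → Cube n → ℤ
coeff [] Q = 0ℤ
coeff ((k , P) ∷ c) Q with P ≟C Q
... | yes _ = k + coeff c Q
... | no  _ = coeff c Q

scale : ∀ {n} → ℤ → Chain n → Chain n
scale m = map (λ { (k , P) → (m * k , P) })

∂I : Interval → List (ℤ × Interval)
∂I (a , false) = []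
∂I (a , true)  = (1ℤ , (a + 1ℤ , false)) ∷ (-1ℤ , (a , false)) ∷ []

sgnI : Interval → ℤ
sgnI (_ , false) = 1ℤ
sgnI (_ , true)  = -1ℤ

∂Cube : ∀ {n} → Cube n → Chain n
∂Cube [] = []
∂Cube (I ∷ Q) =
  map (λ { (k , J) → (k , J ∷ Q) }) (∂I I)
  ++ scale (sgnI I) (map (λ { (k , P) → (k , I ∷ P) }) (∂Cube Q))

∂ : ∀ {n} → Chain n → Chain n
∂ = concatMap (λ { (k , P) → scale k (∂Cube P) })

SupportedIn : ∀ {n} → CubeSet n → ℕ → Chain n → Set
SupportedIn K k c = All (λ { (_ , P) → K P × dim P ≡ k }) c

IsCycle : ∀ {n} → Chain n → Set
IsCycle c = ∀ Q → coeff (∂ c) Q ≡ 0ℤ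

-- H_k(X) = 0: every k-cycle of X is the boundary of a (k+1)-chain of X
-- (chains compared as formal sums, i.e. coefficientwise)
HomologyTrivial : ∀ {n} → CubeSet n → ℕ → Set
HomologyTrivial K k =
  ∀ c → SupportedIn K k c → IsCycle c →
  ∃ λ d → SupportedIn K (suc k) d × (∀ Q → coeff (∂ d) Q ≡ coeff c Q)

NonEmpty : ∀ {n} → CubeSet n → Set
NonEmpty K = ∃ λ Q → K Q

Adjacent : ∀ {n} → CubeSet n → Cube n → Cube n → Set
Adjacent K v w = ∃ λ E → K E × dim E ≡ 1 × v ⊑ E × w ⊑ E

Connected : ∀ {n} → CubeSet n → Set
Connected K = ∀ v w → K v → K w → dim v ≡ 0 → dim w ≡ 0 → Star (Adjacent K) v w

Acyclic : ∀ {n} → CubeSet n → Set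
Acyclic K = NonEmpty K × Connected K × (∀ k → 1 ≤ k → HomologyTrivial K k)

Family : ℕ → Set
Family n = Subset n → Bool

_∈F_ : ∀ {n} → Subset n → Family n → Set
A ∈F 𝓕 = 𝓕 A ≡ true

IntervalIn : ∀ {n} → Family n → Subset n → Subset n → Set
IntervalIn 𝓕 A B = ∀ C → A ⊆ C → C ⊆ B → C ∈F 𝓕

SimplyRooted : ∀ {n} → Family n → Set
SimplyRooted 𝓕 = ∀ A → A ∈F 𝓕 → Nonempty A →
  ∃ λ i → i ∈ₛ A × IntervalIn 𝓕 ⁅ i ⁆ A

IsCubeOf : ∀ {n} → Family n → Subset n → Subset n → Set
IsCubeOf 𝓕 A B = A ⊆ B × IntervalIn 𝓕 A B

realI : Bool → Bool → Interval
realI true  _     = (+ 1 , false)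
realI false true  = (+ 0 , true)
realI false false = (+ 0 , false)

real : ∀ {n} → Subset n → Subset n → Cube n
real A B = zipWith realI A B

-- X(𝓕) = ⋃_{[A,B] ∈ 𝒞(𝓕)} |[A,B]|, given by its elementary cubes:
-- the faces of the cubes |[A,B]|, [A,B] ∈ 𝒞(𝓕)
X : ∀ {n} → Family n → CubeSet n
X 𝓕 Q = ∃₂ λ A B → IsCubeOf 𝓕 A B × Q ⊑ real A B

{-# OPTIONS --safe #-}

-- A cube of X(𝓕) is |[C, D]| with [C, D] ⊆ 𝓕. For D ≠ ∅ descend from D by deleting simple
-- roots, D ⊃ D - r(D) ⊃ …, as long as the root lies outside C and the set does not become
-- empty; let T be where this stops and j its pivot (an element of T other than r(T), or r(T)
-- if there is none). Adding j to C or deleting it does not change the descent, and simple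
-- rootedness keeps the resulting intervals inside 𝓕, so the cubes with D ≠ ∅ split into pairs
-- |[C ∪ j, D]| ⊂ |[C, D]| of a cube and a facet. Every other coface of a lower cube lies in a
-- pair of lexicographically smaller rank (n - |D|, |T|, |C - j|), so the pairs can be collapsed
-- one at a time in order of rank. Elementary collapses preserve connectedness and homology, and
-- what remains is the single vertex |[∅, ∅]|.

module Submission where

open import Defs
open import Data.Nat using (ℕ; _≤_; zero; suc)
open import Data.Bool using (true)
open import Relation.Binary.PropositionalEquality using (_≡_)
open import Data.Fin using (Fin; zero)
open import Data.Fin.Subset using (Subset) renaming (⊥ to ∅)
open import Data.Product using (_,_)

module Chains where

  open import Data.Nat as ℕ using (ℕ; suc; z≤n; s≤s)
  import Data.Nat.Properties as ℕ
  open import Data.Integer using (ℤ; _+_; _-_; _*_; -_; 0ℤ; 1ℤ; -1ℤ)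
  open import Data.Integer.Properties
  open import Data.Integer.Tactic.RingSolver using (solve-∀)
  open import Data.List using ([]; _∷_; _++_; length)
  open import Data.List.Relation.Unary.All using (All; []; _∷_)
  open import Data.Product using (_×_; _,_)
  open import Relation.Binary.PropositionalEquality
  open import Relation.Nullary using (yes; no)
  open import Data.Empty using (⊥-elim)
  open import Function using (_∘_)

  private variable n : ℕ

  infix 4 _≈_

  _≈_ : Chain n → Chain n → Set
  c ≈ d = ∀ Q → coeff c Q ≡ coeff d Q

  δ : Cube n → Cube n → ℤ
  δ P Q with P ≟C Q
  ... | yes _ = 1ℤ
  ... | no  _ = 0ℤ

  δ-refl : (P : Cube n) → δ P P ≡ 1ℤ
  δ-refl P with P ≟C P
  ... | yes _ = refl
  ... | no P≢P = ⊥-elim (P≢P refl)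

  δ-≢ : {P Q : Cube n} → P ≢ Q → δ P Q ≡ 0ℤ
  δ-≢ {P = P} {Q} P≢Q with P ≟C Q
  ... | yes P≡Q = ⊥-elim (P≢Q P≡Q)
  ... | no  _   = refl

  record IsLinearExtension (Φ : Chain n → ℤ) (φ : Cube n → ℤ) : Set where
    field
      Φ-[] : Φ [] ≡ 0ℤ
      Φ-∷  : ∀ k P c → Φ ((k , P) ∷ c) ≡ k * φ P + Φ c

  coeff-∷ : ∀ k (P : Cube n) c Q → coeff ((k , P) ∷ c) Q ≡ k * δ P Q + coeff c Q
  coeff-∷ k P c Q with P ≟C Q
  ... | yes _ = cong (_+ coeff c Q) (sym (*-identityʳ k))
  ... | no  _ = sym (trans (cong (_+ coeff c Q) (*-zeroʳ k)) (+-identityˡ _))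

  coeff-linear : (Q : Cube n) → IsLinearExtension (λ c → coeff c Q) (λ P → δ P Q)
  coeff-linear Q = record { Φ-[] = refl ; Φ-∷ = λ k P c → coeff-∷ k P c Q }

  remove : Cube n → Chain n → Chain n
  remove P [] = []
  remove P ((k , Q) ∷ c) with Q ≟C P
  ... | yes _ = remove P c
  ... | no  _ = (k , Q) ∷ remove P c

  length-remove : ∀ (P : Cube n) c → length (remove P c) ℕ.≤ length c
  length-remove P [] = z≤n
  length-remove P ((k , Q) ∷ c) with Q ≟C P
  ... | yes _ = ℕ.m≤n⇒m≤1+n (length-remove P c)
  ... | no  _ = s≤s (length-remove P c)

  remove-head : ∀ k (P : Cube n) c → remove P ((k , P) ∷ c) ≡ remove P c
  remove-head k P c with P ≟C P
  ... | yes _ = refl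
  ... | no P≢P = ⊥-elim (P≢P refl)

  coeff-remove-self : ∀ (P : Cube n) c → coeff (remove P c) P ≡ 0ℤ
  coeff-remove-self P [] = refl
  coeff-remove-self P ((k , Q) ∷ c) with Q ≟C P
  ... | yes _ = coeff-remove-self P c
  ... | no Q≢P = begin
    coeff ((k , Q) ∷ remove P c) P   ≡⟨ coeff-∷ k Q (remove P c) P ⟩
    k * δ Q P + coeff (remove P c) P ≡⟨ cong₂ _+_ (trans (cong (k *_) (δ-≢ Q≢P)) (*-zeroʳ k)) (coeff-remove-self P c) ⟩
    0ℤ                               ∎
    where open ≡-Reasoning

  coeff-remove-other : ∀ {P R : Cube n} c → R ≢ P → coeff (remove P c) R ≡ coeff c R
  coeff-remove-other [] _ = refl
  coeff-remove-other {P = P} {R} ((k , Q) ∷ c) R≢P with Q ≟C P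
  ... | yes refl = begin
    coeff (remove P c) R      ≡⟨ coeff-remove-other c R≢P ⟩
    coeff c R                 ≡⟨ sym (+-identityˡ _) ⟩
    0ℤ + coeff c R            ≡⟨ cong (_+ coeff c R) (sym (trans (cong (k *_) (δ-≢ (R≢P ∘ sym))) (*-zeroʳ k))) ⟩
    k * δ P R + coeff c R     ≡⟨ sym (coeff-∷ k P c R) ⟩
    coeff ((k , P) ∷ c) R     ∎
    where open ≡-Reasoning
  ... | no _ = begin
    coeff ((k , Q) ∷ remove P c) R    ≡⟨ coeff-∷ k Q (remove P c) R ⟩
    k * δ Q R + coeff (remove P c) R  ≡⟨ cong (k * δ Q R +_) (coeff-remove-other c R≢P) ⟩
    k * δ Q R + coeff c R             ≡⟨ sym (coeff-∷ k Q c R) ⟩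
    coeff ((k , Q) ∷ c) R             ∎
    where open ≡-Reasoning

  remove-≈ : ∀ (P : Cube n) c → coeff c P ≡ 0ℤ → remove P c ≈ c
  remove-≈ P c cP≡0 R with R ≟C P
  ... | yes refl = trans (coeff-remove-self P c) (sym cP≡0)
  ... | no R≢P   = coeff-remove-other c R≢P

  All-remove : ∀ {Pr : Cube n → Set} R c → All (λ (_ , P) → Pr P) c → All (λ (_ , P) → Pr P × P ≢ R) (remove R c)
  All-remove R [] [] = []
  All-remove R ((k , Q) ∷ c) (PrQ ∷ rest) with Q ≟C R
  ... | yes _   = All-remove R c rest
  ... | no Q≢R  = (PrQ , Q≢R) ∷ All-remove R c rest

  module LinearExtension {Φ : Chain n → ℤ} {φ : Cube n → ℤ} (L : IsLinearExtension Φ φ) where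
    open IsLinearExtension L

    ++-additive : ∀ c d → Φ (c ++ d) ≡ Φ c + Φ d
    ++-additive [] d = sym (trans (cong (_+ Φ d) Φ-[]) (+-identityˡ _))
    ++-additive ((k , P) ∷ c) d = begin
      Φ ((k , P) ∷ c ++ d)      ≡⟨ Φ-∷ k P (c ++ d) ⟩
      k * φ P + Φ (c ++ d)      ≡⟨ cong (k * φ P +_) (++-additive c d) ⟩
      k * φ P + (Φ c + Φ d)     ≡⟨ sym (+-assoc (k * φ P) (Φ c) (Φ d)) ⟩
      k * φ P + Φ c + Φ d       ≡⟨ cong (_+ Φ d) (sym (Φ-∷ k P c)) ⟩
      Φ ((k , P) ∷ c) + Φ d     ∎
      where open ≡-Reasoning

    scale-homogeneous : ∀ m c → Φ (scale m c) ≡ m * Φ c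
    scale-homogeneous m [] = trans Φ-[] (sym (trans (cong (m *_) Φ-[]) (*-zeroʳ m)))
    scale-homogeneous m ((k , P) ∷ c) = begin
      Φ ((m * k , P) ∷ scale m c)   ≡⟨ Φ-∷ (m * k) P (scale m c) ⟩
      m * k * φ P + Φ (scale m c)   ≡⟨ cong (m * k * φ P +_) (scale-homogeneous m c) ⟩
      m * k * φ P + m * Φ c         ≡⟨ distribute m k (φ P) (Φ c) ⟩
      m * (k * φ P + Φ c)           ≡⟨ cong (m *_) (sym (Φ-∷ k P c)) ⟩
      m * Φ ((k , P) ∷ c)           ∎
      where
      open ≡-Reasoning
      distribute : ∀ m k x y → m * k * x + m * y ≡ m * (k * x + y)
      distribute = solve-∀

    split-at : ∀ P c → Φ c ≡ coeff c P * φ P + Φ (remove P c)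
    split-at P [] = trans Φ-[] (sym (trans (cong (0ℤ * φ P +_) Φ-[]) (+-identityʳ _)))
    split-at P ((k , Q) ∷ c) with Q ≟C P
    ... | yes refl = begin
      Φ ((k , P) ∷ c)                                 ≡⟨ Φ-∷ k P c ⟩
      k * φ P + Φ c                                   ≡⟨ cong (k * φ P +_) (split-at P c) ⟩
      k * φ P + (coeff c P * φ P + Φ (remove P c))    ≡⟨ collect k (φ P) (coeff c P) (Φ (remove P c)) ⟩
      (k + coeff c P) * φ P + Φ (remove P c)          ∎
      where
      open ≡-Reasoning
      collect : ∀ k x a r → k * x + (a * x + r) ≡ (k + a) * x + r
      collect = solve-∀
    ... | no _ = begin
      Φ ((k , Q) ∷ c)                                 ≡⟨ Φ-∷ k Q c ⟩
      k * φ Q + Φ c                                   ≡⟨ cong (k * φ Q +_) (split-at P c) ⟩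
      k * φ Q + (coeff c P * φ P + Φ (remove P c))    ≡⟨ swap (k * φ Q) (coeff c P * φ P) (Φ (remove P c)) ⟩
      coeff c P * φ P + (k * φ Q + Φ (remove P c))    ≡⟨ cong (coeff c P * φ P +_) (sym (Φ-∷ k Q (remove P c))) ⟩
      coeff c P * φ P + Φ ((k , Q) ∷ remove P c)      ∎
      where
      open ≡-Reasoning
      swap : ∀ x y r → x + (y + r) ≡ y + (x + r)
      swap = solve-∀

    vanishes-on-support : ∀ c → All (λ { (_ , P) → φ P ≡ 0ℤ }) c → Φ c ≡ 0ℤ
    vanishes-on-support [] [] = Φ-[]
    vanishes-on-support ((k , P) ∷ c) (φP≡0 ∷ rest) = begin
      Φ ((k , P) ∷ c)   ≡⟨ Φ-∷ k P c ⟩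
      k * φ P + Φ c     ≡⟨ cong₂ _+_ (trans (cong (k *_) φP≡0) (*-zeroʳ k)) (vanishes-on-support c rest) ⟩
      0ℤ                ∎
      where open ≡-Reasoning

  coeff-++ : ∀ (c d : Chain n) Q → coeff (c ++ d) Q ≡ coeff c Q + coeff d Q
  coeff-++ c d Q = LinearExtension.++-additive (coeff-linear Q) c d

  coeff-scale : ∀ m (c : Chain n) Q → coeff (scale m c) Q ≡ m * coeff c Q
  coeff-scale m c Q = LinearExtension.scale-homogeneous (coeff-linear Q) m c

  module _ {Φ : Chain n → ℤ} {φ : Cube n → ℤ} (L : IsLinearExtension Φ φ) where
    open IsLinearExtension L
    open LinearExtension L

    -- a chain with zero coefficients may still be a nonempty list: strip all copies of its first cube and recurse
    linear-vanishes-on-≈[] : ∀ c → c ≈ [] → Φ c ≡ 0ℤ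
    linear-vanishes-on-≈[] c = go (length c) c ℕ.≤-refl
      where
      go : ∀ fuel c → length c ℕ.≤ fuel → c ≈ [] → Φ c ≡ 0ℤ
      go _ [] _ _ = Φ-[]
      go (suc fuel) ((k , P) ∷ c) (s≤s len≤) c≈[] = begin
        Φ ((k , P) ∷ c)                              ≡⟨ split-at P ((k , P) ∷ c) ⟩
        coeff ((k , P) ∷ c) P * φ P + Φ (remove P ((k , P) ∷ c))
          ≡⟨ cong₂ (λ a d → a * φ P + Φ d) (c≈[] P) (remove-head k P c) ⟩
        0ℤ * φ P + Φ (remove P c)                   ≡⟨ +-identityˡ _ ⟩
        Φ (remove P c)                               ≡⟨ go fuel (remove P c) (ℕ.≤-trans (length-remove P c) len≤) rest≈[] ⟩
        0ℤ                                           ∎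
        where
        open ≡-Reasoning
        rest≈[] : remove P c ≈ []
        rest≈[] R = begin
          coeff (remove P c) R                 ≡⟨ cong (λ d → coeff d R) (sym (remove-head k P c)) ⟩
          coeff (remove P ((k , P) ∷ c)) R     ≡⟨ remove-≈ P ((k , P) ∷ c) (c≈[] P) R ⟩
          coeff ((k , P) ∷ c) R                ≡⟨ c≈[] R ⟩
          0ℤ                                   ∎

    linear-resp-≈ : ∀ c d → c ≈ d → Φ c ≡ Φ d
    linear-resp-≈ c d c≈d = i-j≡0⇒i≡j (Φ c) (Φ d) (begin
      Φ c - Φ d                     ≡⟨ cong (Φ c +_) (sym (-1*i≡-i (Φ d))) ⟩
      Φ c + -1ℤ * Φ d               ≡⟨ cong (Φ c +_) (sym (scale-homogeneous -1ℤ d)) ⟩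
      Φ c + Φ (scale -1ℤ d)         ≡⟨ sym (++-additive c (scale -1ℤ d)) ⟩
      Φ (c ++ scale -1ℤ d)          ≡⟨ linear-vanishes-on-≈[] (c ++ scale -1ℤ d) difference≈[] ⟩
      0ℤ                            ∎)
      where
      open ≡-Reasoning
      difference≈[] : c ++ scale -1ℤ d ≈ []
      difference≈[] Q = begin
        coeff (c ++ scale -1ℤ d) Q     ≡⟨ coeff-++ c (scale -1ℤ d) Q ⟩
        coeff c Q + coeff (scale -1ℤ d) Q ≡⟨ cong₂ _+_ (c≈d Q) (trans (coeff-scale -1ℤ d Q) (-1*i≡-i (coeff d Q))) ⟩
        coeff d Q - coeff d Q          ≡⟨ +-inverseʳ (coeff d Q) ⟩
        0ℤ                             ∎

  ∂-linear : (Q : Cube n) → IsLinearExtension (λ c → coeff (∂ c) Q) (λ P → coeff (∂Cube P) Q)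
  ∂-linear Q = record
    { Φ-[] = refl
    ; Φ-∷  = λ k P c → trans (coeff-++ (scale k (∂Cube P)) (∂ c) Q) (cong (_+ coeff (∂ c) Q) (coeff-scale k (∂Cube P) Q))
    }

  coeff-∂-++ : ∀ (c d : Chain n) Q → coeff (∂ (c ++ d)) Q ≡ coeff (∂ c) Q + coeff (∂ d) Q
  coeff-∂-++ c d Q = LinearExtension.++-additive (∂-linear Q) c d

  coeff-∂-scale : ∀ m (c : Chain n) Q → coeff (∂ (scale m c)) Q ≡ m * coeff (∂ c) Q
  coeff-∂-scale m c Q = LinearExtension.scale-homogeneous (∂-linear Q) m c

  ∂-resp-≈ : ∀ (c d : Chain n) → c ≈ d → ∂ c ≈ ∂ d
  ∂-resp-≈ c d c≈d Q = linear-resp-≈ (∂-linear Q) c d c≈d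

  ∂-add-cube : ∀ (d c : Chain n) m (σ : Cube n) → ∂ d ≈ c ++ scale (- m) (∂Cube σ) → ∂ (d ++ (m , σ) ∷ []) ≈ c
  ∂-add-cube d c m σ ∂d≈ Q = begin
    coeff (∂ (d ++ (m , σ) ∷ [])) Q                           ≡⟨ coeff-∂-++ d ((m , σ) ∷ []) Q ⟩
    coeff (∂ d) Q + coeff (∂ ((m , σ) ∷ [])) Q                ≡⟨ cong₂ _+_ (∂d≈ Q) (IsLinearExtension.Φ-∷ (∂-linear Q) m σ []) ⟩
    coeff (c ++ scale (- m) (∂Cube σ)) Q + (m * x + 0ℤ)      ≡⟨ cong (_+ (m * x + 0ℤ)) (coeff-++ c (scale (- m) (∂Cube σ)) Q) ⟩
    coeff c Q + coeff (scale (- m) (∂Cube σ)) Q + (m * x + 0ℤ) ≡⟨ cong (λ y → coeff c Q + y + (m * x + 0ℤ)) (coeff-scale (- m) (∂Cube σ) Q) ⟩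
    coeff c Q + - m * x + (m * x + 0ℤ)                        ≡⟨ cancel (coeff c Q) m x ⟩
    coeff c Q                                                 ∎
    where
    open ≡-Reasoning
    x = coeff (∂Cube σ) Q
    cancel : ∀ a m x → a + - m * x + (m * x + 0ℤ) ≡ a
    cancel = solve-∀

module Boundary where

  open Chains
  open import Data.Nat as ℕ using (ℕ; suc; z≤n)
  import Data.Nat.Properties as ℕ
  open import Data.Integer using (ℤ; _+_; _-_; _*_; 0ℤ; 1ℤ; -1ℤ)
  open import Data.Integer.Properties
  open import Data.Integer.Tactic.RingSolver using (solve-∀)
  open import Data.Bool using (false; true)
  open import Data.Vec using ([]; _∷_)
  open import Data.Vec.Properties using (∷-injectiveˡ; ∷-injectiveʳ)
  open import Data.Vec.Relation.Binary.Pointwise.Inductive using ([]; _∷_)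
  open import Data.List using (List; []; _∷_; _++_; map)
  open import Data.List.Relation.Unary.All as All using (All; []; _∷_)
  import Data.List.Relation.Unary.All.Properties as All
  open import Data.Product using (_×_; _,_; proj₁)
  open import Data.Sum using (_⊎_; inj₁; inj₂)
  open import Relation.Binary.PropositionalEquality
  open import Relation.Nullary using (¬_; Dec; yes; no; contradiction)
  open import Data.Empty using (⊥-elim)
  open import Function using (_∘_)

  private variable n : ℕ

  Facet : Cube n → Cube n → Set
  Facet τ σ = τ ⊑ σ × dim σ ≡ suc (dim τ)

  ⊑I-trans : ∀ {I J L} → I ⊑I J → J ⊑I L → I ⊑I L
  ⊑I-trans same      J⊑L  = J⊑L
  ⊑I-trans left      same = left
  ⊑I-trans (right e) same = right e

  ⊑-refl : {P : Cube n} → P ⊑ P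
  ⊑-refl {P = []}    = []
  ⊑-refl {P = _ ∷ _} = same ∷ ⊑-refl

  ⊑-trans : {P Q R : Cube n} → P ⊑ Q → Q ⊑ R → P ⊑ R
  ⊑-trans []       []       = []
  ⊑-trans (p ∷ ps) (q ∷ qs) = ⊑I-trans p q ∷ ⊑-trans ps qs

  dimI-mono : ∀ {I J} → J ⊑I I → dimI J ℕ.≤ dimI I
  dimI-mono same      = ℕ.≤-refl
  dimI-mono left      = z≤n
  dimI-mono (right _) = z≤n

  dim-mono : {P Q : Cube n} → Q ⊑ P → dim Q ℕ.≤ dim P
  dim-mono []       = z≤n
  dim-mono (p ∷ ps) = ℕ.+-mono-≤ (dimI-mono p) (dim-mono ps)

  ⊑∧dim≡⇒≡ : {P Q : Cube n} → Q ⊑ P → dim Q ≡ dim P → Q ≡ P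
  ⊑∧dim≡⇒≡ [] _ = refl
  ⊑∧dim≡⇒≡ {P = I ∷ P} {J ∷ Q} (J⊑I ∷ Q⊑P) dim≡ =
    cong₂ _∷_ (head-≡ J⊑I dimI≡) (⊑∧dim≡⇒≡ Q⊑P (ℕ.+-cancelˡ-≡ (dimI J) (dim Q) (dim P) (trans dim≡ (cong (ℕ._+ dim P) (sym dimI≡)))))
    where
    dimI≡ : dimI J ≡ dimI I
    dimI≡ = ℕ.≤-antisym (dimI-mono J⊑I)
              (ℕ.+-cancelʳ-≤ (dim P) (dimI I) (dimI J) (ℕ.≤-trans (ℕ.≤-reflexive (sym dim≡)) (ℕ.+-monoʳ-≤ (dimI J) (dim-mono Q⊑P))))
    head-≡ : ∀ {I J} → J ⊑I I → dimI J ≡ dimI I → J ≡ I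
    head-≡ same      _ = refl
    head-≡ left      ()
    head-≡ (right _) ()

  a+1≢a : ∀ a → (a + 1ℤ , false) ≢ (a , false)
  a+1≢a a a+1≡a = contradiction 1≡0 λ ()
    where
    a+1-a≡1 : ∀ a → a + 1ℤ - a ≡ 1ℤ
    a+1-a≡1 = solve-∀
    1≡0 : 1ℤ ≡ 0ℤ
    1≡0 = begin
      1ℤ          ≡⟨ sym (a+1-a≡1 a) ⟩
      a + 1ℤ - a  ≡⟨ cong (λ I → proj₁ I - a) a+1≡a ⟩
      a - a       ≡⟨ +-inverseʳ a ⟩
      0ℤ          ∎
      where open ≡-Reasoning

  δI : Interval → Interval → ℤ
  δI I J with I ≟I J
  ... | yes _ = 1ℤ
  ... | no  _ = 0ℤ

  δI-refl : ∀ I → δI I I ≡ 1ℤ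
  δI-refl I with I ≟I I
  ... | yes _ = refl
  ... | no I≢I = ⊥-elim (I≢I refl)

  δI-≢ : ∀ {I J} → I ≢ J → δI I J ≡ 0ℤ
  δI-≢ {I} {J} I≢J with I ≟I J
  ... | yes I≡J = ⊥-elim (I≢J I≡J)
  ... | no  _   = refl

  δ-∷ : ∀ I J (P Q : Cube n) → δ (I ∷ P) (J ∷ Q) ≡ δI I J * δ P Q
  δ-∷ I J P Q = by-cases (I ≟I J) (P ≟C Q)
    where
    by-cases : Dec (I ≡ J) → Dec (P ≡ Q) → δ (I ∷ P) (J ∷ Q) ≡ δI I J * δ P Q
    by-cases (yes refl) (yes refl) = trans (δ-refl (I ∷ P)) (sym (cong₂ _*_ (δI-refl I) (δ-refl P)))
    by-cases (yes refl) (no P≢Q)   = trans (δ-≢ (P≢Q ∘ ∷-injectiveʳ)) (sym (trans (cong (δI I I *_) (δ-≢ P≢Q)) (*-zeroʳ (δI I I))))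
    by-cases (no I≢J)   _          = trans (δ-≢ (I≢J ∘ ∷-injectiveˡ)) (sym (trans (cong (_* δ P Q) (δI-≢ I≢J)) (*-zeroˡ (δ P Q))))

  IntervalChain : Set
  IntervalChain = List (ℤ × Interval)

  cI : IntervalChain → Interval → ℤ
  cI []            J = 0ℤ
  cI ((k , I) ∷ l) J = k * δI I J + cI l J

  infixr 6 _◃_ _▹_

  _◃_ : Interval → Chain n → Chain (suc n)
  I ◃ c = map (λ (k , P) → (k , I ∷ P)) c

  _▹_ : IntervalChain → Cube n → Chain (suc n)
  l ▹ P = map (λ (k , J) → (k , J ∷ P)) l

  coeff-◃ : ∀ I (c : Chain n) J Q → coeff (I ◃ c) (J ∷ Q) ≡ δI I J * coeff c Q
  coeff-◃ I [] J Q = sym (*-zeroʳ (δI I J))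
  coeff-◃ I ((k , P) ∷ c) J Q = begin
    coeff ((k , I ∷ P) ∷ I ◃ c) (J ∷ Q)             ≡⟨ coeff-∷ k (I ∷ P) (I ◃ c) (J ∷ Q) ⟩
    k * δ (I ∷ P) (J ∷ Q) + coeff (I ◃ c) (J ∷ Q)   ≡⟨ cong₂ (λ d e → k * d + e) (δ-∷ I J P Q) (coeff-◃ I c J Q) ⟩
    k * (δI I J * δ P Q) + δI I J * coeff c Q       ≡⟨ factor k (δI I J) (δ P Q) (coeff c Q) ⟩
    δI I J * (k * δ P Q + coeff c Q)                ≡⟨ cong (δI I J *_) (sym (coeff-∷ k P c Q)) ⟩
    δI I J * coeff ((k , P) ∷ c) Q                  ∎
    where
    open ≡-Reasoning
    factor : ∀ k d e x → k * (d * e) + d * x ≡ d * (k * e + x)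
    factor = solve-∀

  coeff-▹ : ∀ l (P : Cube n) J Q → coeff (l ▹ P) (J ∷ Q) ≡ cI l J * δ P Q
  coeff-▹ [] P J Q = sym (*-zeroˡ (δ P Q))
  coeff-▹ ((k , I) ∷ l) P J Q = begin
    coeff ((k , I ∷ P) ∷ l ▹ P) (J ∷ Q)             ≡⟨ coeff-∷ k (I ∷ P) (l ▹ P) (J ∷ Q) ⟩
    k * δ (I ∷ P) (J ∷ Q) + coeff (l ▹ P) (J ∷ Q)   ≡⟨ cong₂ (λ d e → k * d + e) (δ-∷ I J P Q) (coeff-▹ l P J Q) ⟩
    k * (δI I J * δ P Q) + cI l J * δ P Q           ≡⟨ factor k (δI I J) (δ P Q) (cI l J) ⟩
    (k * δI I J + cI l J) * δ P Q                   ∎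
    where
    open ≡-Reasoning
    factor : ∀ k d e x → k * (d * e) + x * e ≡ (k * d + x) * e
    factor = solve-∀

  coeff-∂Cube-∷ : ∀ I (P : Cube n) J Q →
    coeff (∂Cube (I ∷ P)) (J ∷ Q) ≡ cI (∂I I) J * δ P Q + sgnI I * (δI I J * coeff (∂Cube P) Q)
  coeff-∂Cube-∷ I P J Q = begin
    coeff (∂I I ▹ P ++ scale (sgnI I) (I ◃ ∂Cube P)) (J ∷ Q)
      ≡⟨ coeff-++ (∂I I ▹ P) (scale (sgnI I) (I ◃ ∂Cube P)) (J ∷ Q) ⟩
    coeff (∂I I ▹ P) (J ∷ Q) + coeff (scale (sgnI I) (I ◃ ∂Cube P)) (J ∷ Q)
      ≡⟨ cong₂ _+_ (coeff-▹ (∂I I) P J Q) (coeff-scale (sgnI I) (I ◃ ∂Cube P) (J ∷ Q)) ⟩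
    cI (∂I I) J * δ P Q + sgnI I * coeff (I ◃ ∂Cube P) (J ∷ Q)
      ≡⟨ cong (λ x → cI (∂I I) J * δ P Q + sgnI I * x) (coeff-◃ I (∂Cube P) J Q) ⟩
    cI (∂I I) J * δ P Q + sgnI I * (δI I J * coeff (∂Cube P) Q) ∎
    where open ≡-Reasoning

  ∂Cube-facets : ∀ (P : Cube n) → All (λ (_ , Q) → Facet Q P) (∂Cube P)
  ∂Cube-facets [] = []
  ∂Cube-facets (I ∷ P) = All.++⁺ (endpoint-facets I) (All.map⁺ (All.map⁺ (All.map extend (∂Cube-facets P))))
    where
    endpoint-facets : ∀ I → All (λ (_ , Q) → Facet Q (I ∷ P)) (∂I I ▹ P)
    endpoint-facets (a , false) = []
    endpoint-facets (a , true)  = (right refl ∷ ⊑-refl , refl) ∷ (left ∷ ⊑-refl , refl) ∷ []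
    extend : ∀ {Q} → Facet Q P → Facet (I ∷ Q) (I ∷ P)
    extend {Q} (Q⊑P , dim≡) = same ∷ Q⊑P , trans (cong (dimI I ℕ.+_) dim≡) (ℕ.+-suc (dimI I) (dim Q))

  coeff-∂Cube-nonface : ∀ (P R : Cube n) → ¬ R ⊑ P → coeff (∂Cube P) R ≡ 0ℤ
  coeff-∂Cube-nonface P R R⋢P = LinearExtension.vanishes-on-support (coeff-linear R) (∂Cube P)
    (All.map (λ {(_ , Q)} (Q⊑P , _) → δ-≢ (λ Q≡R → R⋢P (subst (_⊑ P) Q≡R Q⊑P))) (∂Cube-facets P))

  Unit : ℤ → Set
  Unit u = u ≡ 1ℤ ⊎ u ≡ -1ℤ

  unit-* : ∀ {s u} → Unit s → Unit u → Unit (s * u)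
  unit-* (inj₁ refl) (inj₁ refl) = inj₁ refl
  unit-* (inj₁ refl) (inj₂ refl) = inj₂ refl
  unit-* (inj₂ refl) (inj₁ refl) = inj₂ refl
  unit-* (inj₂ refl) (inj₂ refl) = inj₁ refl

  unit-sgnI : ∀ I → Unit (sgnI I)
  unit-sgnI (_ , false) = inj₁ refl
  unit-sgnI (_ , true)  = inj₂ refl

  unit-square : ∀ {u} → Unit u → u * u ≡ 1ℤ
  unit-square (inj₁ refl) = refl
  unit-square (inj₂ refl) = refl

  cI-∂I-self : ∀ I → cI (∂I I) I ≡ 0ℤ
  cI-∂I-self (a , false) = refl
  cI-∂I-self (a , true)  = cong₂ (λ x y → 1ℤ * x + (-1ℤ * y + 0ℤ)) (δI-≢ {a + 1ℤ , false} (λ ())) (δI-≢ {a , false} (λ ()))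

  cI-∂I-left : ∀ a → cI (∂I (a , true)) (a , false) ≡ -1ℤ
  cI-∂I-left a = cong₂ (λ x y → 1ℤ * x + (-1ℤ * y + 0ℤ)) (δI-≢ (a+1≢a a)) (δI-refl (a , false))

  cI-∂I-right : ∀ a → cI (∂I (a , true)) (a + 1ℤ , false) ≡ 1ℤ
  cI-∂I-right a = trans (cong₂ (λ x y → 1ℤ * x + (-1ℤ * y + 0ℤ)) (δI-refl (a + 1ℤ , false)) (δI-≢ (a+1≢a a ∘ sym))) refl

  coeff-∂Cube-∷-same : ∀ I (P Q : Cube n) → coeff (∂Cube (I ∷ P)) (I ∷ Q) ≡ sgnI I * coeff (∂Cube P) Q
  coeff-∂Cube-∷-same I P Q = begin
    coeff (∂Cube (I ∷ P)) (I ∷ Q)                             ≡⟨ coeff-∂Cube-∷ I P I Q ⟩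
    cI (∂I I) I * δ P Q + sgnI I * (δI I I * coeff (∂Cube P) Q)
      ≡⟨ cong₂ (λ x y → x * δ P Q + sgnI I * (y * coeff (∂Cube P) Q)) (cI-∂I-self I) (δI-refl I) ⟩
    0ℤ * δ P Q + sgnI I * (1ℤ * coeff (∂Cube P) Q)            ≡⟨ simplify (δ P Q) (sgnI I) (coeff (∂Cube P) Q) ⟩
    sgnI I * coeff (∂Cube P) Q                                ∎
    where
    open ≡-Reasoning
    simplify : ∀ d s x → 0ℤ * d + s * (1ℤ * x) ≡ s * x
    simplify = solve-∀

  coeff-∂Cube-∷-endpoint : ∀ I J (P : Cube n) → I ≢ J → coeff (∂Cube (I ∷ P)) (J ∷ P) ≡ cI (∂I I) J
  coeff-∂Cube-∷-endpoint I J P I≢J = begin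
    coeff (∂Cube (I ∷ P)) (J ∷ P)                             ≡⟨ coeff-∂Cube-∷ I P J P ⟩
    cI (∂I I) J * δ P P + sgnI I * (δI I J * coeff (∂Cube P) P)
      ≡⟨ cong₂ (λ x y → cI (∂I I) J * x + sgnI I * (y * coeff (∂Cube P) P)) (δ-refl P) (δI-≢ I≢J) ⟩
    cI (∂I I) J * 1ℤ + sgnI I * (0ℤ * coeff (∂Cube P) P)     ≡⟨ simplify (cI (∂I I) J) (sgnI I) (coeff (∂Cube P) P) ⟩
    cI (∂I I) J                                               ∎
    where
    open ≡-Reasoning
    simplify : ∀ c s x → c * 1ℤ + s * (0ℤ * x) ≡ c
    simplify = solve-∀

  facet-incidence-unit : ∀ {σ τ : Cube n} → Facet τ σ → Unit (coeff (∂Cube σ) τ)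
  facet-incidence-unit {σ = I ∷ σ} {I ∷ τ} (same ∷ τ⊑σ , dim≡) =
    subst Unit (sym (coeff-∂Cube-∷-same I σ τ)) (unit-* (unit-sgnI I) (facet-incidence-unit (τ⊑σ , dimσ≡)))
    where
    dimσ≡ : dim σ ≡ suc (dim τ)
    dimσ≡ = ℕ.+-cancelˡ-≡ (dimI I) (dim σ) (suc (dim τ)) (trans dim≡ (sym (ℕ.+-suc (dimI I) (dim τ))))
  facet-incidence-unit {σ = (a , true) ∷ σ} (left ∷ τ⊑σ , dim≡)
    rewrite ⊑∧dim≡⇒≡ τ⊑σ (sym (ℕ.suc-injective dim≡)) =
    inj₂ (trans (coeff-∂Cube-∷-endpoint (a , true) (a , false) σ (λ ())) (cI-∂I-left a))
  facet-incidence-unit {σ = (a , true) ∷ σ} (right refl ∷ τ⊑σ , dim≡)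
    rewrite ⊑∧dim≡⇒≡ τ⊑σ (sym (ℕ.suc-injective dim≡)) =
    inj₁ (trans (coeff-∂Cube-∷-endpoint (a , true) (a + 1ℤ , false) σ (λ ())) (cI-∂I-right a))

  coeff-∂-◃ : ∀ I (c : Chain n) J Q →
    coeff (∂ (I ◃ c)) (J ∷ Q) ≡ cI (∂I I) J * coeff c Q + sgnI I * (δI I J * coeff (∂ c) Q)
  coeff-∂-◃ I [] J Q = sym (solve₀ (cI (∂I I) J) (sgnI I) (δI I J))
    where
    solve₀ : ∀ c s d → c * 0ℤ + s * (d * 0ℤ) ≡ 0ℤ
    solve₀ = solve-∀
  coeff-∂-◃ I ((k , P) ∷ c) J Q = begin
    coeff (∂ ((k , I ∷ P) ∷ I ◃ c)) (J ∷ Q)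
      ≡⟨ IsLinearExtension.Φ-∷ (∂-linear (J ∷ Q)) k (I ∷ P) (I ◃ c) ⟩
    k * coeff (∂Cube (I ∷ P)) (J ∷ Q) + coeff (∂ (I ◃ c)) (J ∷ Q)
      ≡⟨ cong₂ (λ x y → k * x + y) (coeff-∂Cube-∷ I P J Q) (coeff-∂-◃ I c J Q) ⟩
    k * (C * δ P Q + s * (D * coeff (∂Cube P) Q)) + (C * coeff c Q + s * (D * coeff (∂ c) Q))
      ≡⟨ regroup k C (δ P Q) s D (coeff (∂Cube P) Q) (coeff c Q) (coeff (∂ c) Q) ⟩
    C * (k * δ P Q + coeff c Q) + s * (D * (k * coeff (∂Cube P) Q + coeff (∂ c) Q))
      ≡⟨ sym (cong₂ (λ x y → C * x + s * (D * y)) (coeff-∷ k P c Q) (IsLinearExtension.Φ-∷ (∂-linear Q) k P c)) ⟩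
    C * coeff ((k , P) ∷ c) Q + s * (D * coeff (∂ ((k , P) ∷ c)) Q) ∎
    where
    open ≡-Reasoning
    C = cI (∂I I) J
    s = sgnI I
    D = δI I J
    regroup : ∀ k C d s D x c y → k * (C * d + s * (D * x)) + (C * c + s * (D * y)) ≡ C * (k * d + c) + s * (D * (k * x + y))
    regroup = solve-∀

  Vertex : Interval → Set
  Vertex (_ , nondegenerate) = nondegenerate ≡ false

  ∂I-vertices : ∀ I → All (λ (_ , J) → Vertex J) (∂I I)
  ∂I-vertices (_ , false) = []
  ∂I-vertices (_ , true)  = refl ∷ refl ∷ []

  coeff-∂-▹ : ∀ l (P : Cube n) J Q → All (λ (_ , I) → Vertex I) l →
    coeff (∂ (l ▹ P)) (J ∷ Q) ≡ cI l J * coeff (∂Cube P) Q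
  coeff-∂-▹ [] P J Q [] = sym (*-zeroˡ (coeff (∂Cube P) Q))
  coeff-∂-▹ ((k , (b , false)) ∷ l) P J Q (refl ∷ vertices) = begin
    coeff (∂ ((k , (b , false) ∷ P) ∷ l ▹ P)) (J ∷ Q)
      ≡⟨ IsLinearExtension.Φ-∷ (∂-linear (J ∷ Q)) k ((b , false) ∷ P) (l ▹ P) ⟩
    k * coeff (∂Cube ((b , false) ∷ P)) (J ∷ Q) + coeff (∂ (l ▹ P)) (J ∷ Q)
      ≡⟨ cong₂ (λ x y → k * x + y) (coeff-∂Cube-∷ (b , false) P J Q) (coeff-∂-▹ l P J Q vertices) ⟩
    k * (0ℤ * δ P Q + 1ℤ * (δI (b , false) J * ∂PQ)) + cI l J * ∂PQ
      ≡⟨ regroup k (δ P Q) (δI (b , false) J) ∂PQ (cI l J) ⟩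
    (k * δI (b , false) J + cI l J) * ∂PQ ∎
    where
    open ≡-Reasoning
    ∂PQ = coeff (∂Cube P) Q
    regroup : ∀ k d e x c → k * (0ℤ * d + 1ℤ * (e * x)) + c * x ≡ (k * e + c) * x
    regroup = solve-∀

  ∂∂≈[] : ∀ (P : Cube n) → ∂ (∂Cube P) ≈ []
  ∂∂≈[] [] [] = refl
  ∂∂≈[] (I ∷ P) (J ∷ Q) = begin
    coeff (∂ (∂I I ▹ P ++ scale s (I ◃ ∂Cube P))) (J ∷ Q)
      ≡⟨ coeff-∂-++ (∂I I ▹ P) (scale s (I ◃ ∂Cube P)) (J ∷ Q) ⟩
    coeff (∂ (∂I I ▹ P)) (J ∷ Q) + coeff (∂ (scale s (I ◃ ∂Cube P))) (J ∷ Q)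
      ≡⟨ cong₂ _+_ (coeff-∂-▹ (∂I I) P J Q (∂I-vertices I)) (coeff-∂-scale s (I ◃ ∂Cube P) (J ∷ Q)) ⟩
    C * ∂PQ + s * coeff (∂ (I ◃ ∂Cube P)) (J ∷ Q)
      ≡⟨ cong (λ y → C * ∂PQ + s * y) (coeff-∂-◃ I (∂Cube P) J Q) ⟩
    C * ∂PQ + s * (C * ∂PQ + s * (δI I J * coeff (∂ (∂Cube P)) Q))
      ≡⟨ cong (λ y → C * ∂PQ + s * (C * ∂PQ + s * (δI I J * y))) (∂∂≈[] P Q) ⟩
    C * ∂PQ + s * (C * ∂PQ + s * (δI I J * 0ℤ))
      ≡⟨ cancel I ⟩
    0ℤ ∎
    where
    open ≡-Reasoning
    s = sgnI I
    C = cI (∂I I) J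
    ∂PQ = coeff (∂Cube P) Q
    -- a degenerate interval has no boundary; a nondegenerate one has sign -1
    cancel : ∀ I → cI (∂I I) J * ∂PQ + sgnI I * (cI (∂I I) J * ∂PQ + sgnI I * (δI I J * 0ℤ)) ≡ 0ℤ
    cancel (a , false) = degenerate ∂PQ (δI (a , false) J)
      where
      degenerate : ∀ x d → 0ℤ * x + 1ℤ * (0ℤ * x + 1ℤ * (d * 0ℤ)) ≡ 0ℤ
      degenerate = solve-∀
    cancel (a , true) = nondegenerate (cI (∂I (a , true)) J) ∂PQ (δI (a , true) J)
      where
      nondegenerate : ∀ c x d → c * x + -1ℤ * (c * x + -1ℤ * (d * 0ℤ)) ≡ 0ℤ
      nondegenerate = solve-∀

  IsCycle-+∂ : ∀ (c : Chain n) m σ → IsCycle c → IsCycle (c ++ scale m (∂Cube σ))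
  IsCycle-+∂ c m σ c-cycle Q = begin
    coeff (∂ (c ++ scale m (∂Cube σ))) Q               ≡⟨ coeff-∂-++ c (scale m (∂Cube σ)) Q ⟩
    coeff (∂ c) Q + coeff (∂ (scale m (∂Cube σ))) Q    ≡⟨ cong₂ _+_ (c-cycle Q) (coeff-∂-scale m (∂Cube σ) Q) ⟩
    0ℤ + m * coeff (∂ (∂Cube σ)) Q                     ≡⟨ cong (λ x → 0ℤ + m * x) (∂∂≈[] σ Q) ⟩
    0ℤ + m * 0ℤ                                        ≡⟨ cong (0ℤ +_) (*-zeroʳ m) ⟩
    0ℤ                                                 ∎
    where open ≡-Reasoning

module Collapse where

  open Chains
  open Boundary
  open import Data.Nat as ℕ using (ℕ; suc; s≤s; _≤_; _<_)
  open import Data.Nat.Properties using (0≢1+n; 1+n≢n)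
  import Data.Nat.Properties as ℕ
  open import Data.Integer using (ℤ; _+_; _-_; _*_; -_; 0ℤ; 1ℤ)
  open import Data.Integer.Properties
  open import Data.Integer.Tactic.RingSolver using (solve-∀)
  open import Data.Vec using (_∷_)
  open import Data.Vec.Relation.Binary.Pointwise.Inductive using (_∷_)
  open import Data.List using (List; []; _∷_; _++_; length; filter)
  open import Data.List.Properties using (filter-notAll)
  open import Data.List.Extrema.Nat using (argmin; argmin-sel; f[argmin]≤f[⊤]; f[argmin]≤f[xs])
  open import Data.List.Membership.Propositional using (_∈_)
  open import Data.List.Membership.Propositional.Properties using (∈-filter⁺; ∈-filter⁻)
  open import Data.List.Relation.Unary.Any as Any using (here; there)
  open import Data.List.Relation.Unary.All as All using (All; []; _∷_)
  import Data.List.Relation.Unary.All.Properties as All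
  open import Data.Product using (∃; _×_; _,_; proj₁; proj₂)
  open import Data.Sum using (_⊎_; inj₁; inj₂; [_,_]′)
  open import Relation.Binary.PropositionalEquality
  open import Relation.Binary.Construct.Closure.ReflexiveTransitive using (Star; ε; _◅_; _◅◅_; gmap)
  open import Relation.Nullary using (¬_; yes; no; ¬?)
  open import Relation.Nullary.Decidable using (map′; _×-dec_)
  open import Relation.Binary.Definitions using (DecidableEquality)
  open import Relation.Unary using (_⊆_)
  open import Data.Empty using (⊥-elim)
  open import Function using (id; _∘_)
  open import Data.Vec.Properties using (∷-injectiveˡ; ∷-injectiveʳ)
  open import Data.Bool using (false; true)

  private variable n : ℕ

  HigherHomologyTrivial : CubeSet n → Set
  HigherHomologyTrivial K = ∀ k → 1 ≤ k → HomologyTrivial K k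

  AcyclicOrEmpty : CubeSet n → Set
  AcyclicOrEmpty K = Connected K × HigherHomologyTrivial K

  FaceClosed : CubeSet n → Set
  FaceClosed K = ∀ {P Q} → K P → Q ⊑ P → K Q

  Without : CubeSet n → Cube n → Cube n → CubeSet n
  Without K τ σ Q = K Q × Q ≢ τ × Q ≢ σ

  FreeFacet : CubeSet n → Cube n → Cube n → Set
  FreeFacet K τ σ = ∀ {P} → K P → τ ⊑ P → P ≡ τ ⊎ P ≡ σ

  supported-mono : ∀ {K K′ : CubeSet n} {k} → K ⊆ K′ → ∀ {c} → SupportedIn K k c → SupportedIn K′ k c
  supported-mono K⊆K′ = All.map (λ (KP , dim≡) → K⊆K′ KP , dim≡)

  edge-path-mono : ∀ {K K′ : CubeSet n} → K ⊆ K′ → ∀ {v w} → Star (Adjacent K) v w → Star (Adjacent K′) v w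
  edge-path-mono K⊆K′ = gmap id (λ (E , KE , rest) → E , K⊆K′ KE , rest)

  AcyclicOrEmpty-≐ : ∀ {K K′ : CubeSet n} → K ⊆ K′ → K′ ⊆ K → AcyclicOrEmpty K → AcyclicOrEmpty K′
  AcyclicOrEmpty-≐ K⊆K′ K′⊆K (connected , trivial) =
    (λ v w K′v K′w dimv dimw → edge-path-mono K⊆K′ (connected v w (K′⊆K K′v) (K′⊆K K′w) dimv dimw)) ,
    λ k 1≤k c c-in-K′ cycle →
      let (d , d-in-K , ∂d≈c) = trivial k 1≤k c (supported-mono K′⊆K c-in-K′) cycle
      in d , supported-mono K⊆K′ d-in-K , ∂d≈c

  other-endpoint : ∀ {σ τ : Cube n} → dim σ ≡ 1 → τ ⊑ σ → dim τ ≡ 0 → ∃ λ w → w ⊑ σ × dim w ≡ 0 × w ≢ τ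
  other-endpoint {σ = (a , true)  ∷ σ} _    (same ∷ _) ()
  other-endpoint {σ = (a , false) ∷ σ} dimσ (same ∷ τ⊑σ) dimτ =
    let (w , w⊑σ , dimw , w≢τ) = other-endpoint dimσ τ⊑σ dimτ
    in (a , false) ∷ w , same ∷ w⊑σ , dimw , w≢τ ∘ ∷-injectiveʳ
  other-endpoint {σ = (a , true) ∷ σ} dimσ (left ∷ _) _ =
    (a + 1ℤ , false) ∷ σ , right refl ∷ ⊑-refl , ℕ.suc-injective dimσ , a+1≢a a ∘ ∷-injectiveˡ
  other-endpoint {σ = (a , true) ∷ σ} dimσ (right refl ∷ _) _ =
    (a , false) ∷ σ , left ∷ ⊑-refl , ℕ.suc-injective dimσ , a+1≢a a ∘ sym ∘ ∷-injectiveˡ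

  module ElementaryCollapse {K : CubeSet n} {τ σ : Cube n}
    (closed : FaceClosed K) (Kσ : K σ) (τ⋖σ : Facet τ σ) (free : FreeFacet K τ σ) where

    private
      τ⊑σ = proj₁ τ⋖σ
      dimσ = proj₂ τ⋖σ

    connected : Connected (Without K τ σ) → Connected K
    connected connected′ v w Kv Kw dimv dimw =
      let (v′ , K′v′ , dimv′ , v→v′ , _) = into-K′ Kv dimv
          (w′ , K′w′ , dimw′ , _ , w′→w) = into-K′ Kw dimw
      in v→v′ ◅◅ edge-path-mono proj₁ (connected′ v′ w′ K′v′ K′w′ dimv′ dimw′) ◅◅ w′→w
      where
      into-K′ : ∀ {v} → K v → dim v ≡ 0 →
        ∃ λ v′ → Without K τ σ v′ × dim v′ ≡ 0 × Star (Adjacent K) v v′ × Star (Adjacent K) v′ v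
      into-K′ {v} Kv dimv with v ≟C τ | v ≟C σ
      ... | yes refl | _ =
        let dimσ≡1 = trans dimσ (cong suc dimv)
            (w , w⊑σ , dimw , w≢τ) = other-endpoint dimσ≡1 τ⊑σ dimv
        in w , (closed Kσ w⊑σ , w≢τ , λ w≡σ → 0≢1+n (trans (sym dimw) (trans (cong dim w≡σ) dimσ≡1))) , dimw ,
           (σ , Kσ , dimσ≡1 , τ⊑σ , w⊑σ) ◅ ε , (σ , Kσ , dimσ≡1 , w⊑σ , τ⊑σ) ◅ ε
      ... | no _ | yes refl = ⊥-elim (0≢1+n (trans (sym dimv) dimσ))
      ... | no v≢τ | no v≢σ = v , (Kv , v≢τ , v≢σ) , dimv , ε , ε

    private
      u : ℤ
      u = coeff (∂Cube σ) τ

      u*u≡1 : u * u ≡ 1ℤ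
      u*u≡1 = unit-square (facet-incidence-unit τ⋖σ)

      facet-dim-≢σ : ∀ {P} → dim P ≡ dim τ → P ≢ σ
      facet-dim-≢σ dimP P≡σ = 1+n≢n (trans (sym dimσ) (trans (cong dim (sym P≡σ)) dimP))

      coface-dim-≢τ : ∀ {P} → dim P ≡ dim σ → P ≢ τ
      coface-dim-≢τ dimP P≡τ = 1+n≢n (trans (sym dimσ) (trans (sym dimP) (cong dim P≡τ)))

    fill-facet-dimension : HomologyTrivial (Without K τ σ) (dim τ) → HomologyTrivial K (dim τ)
    fill-facet-dimension trivial′ c c-in-K c-cycle = lift (trivial′ c₂ c₂-in-K′ c₂-cycle)
      where
      open ≡-Reasoning
      a = coeff c τ
      m = - (a * u)
      -- subtracting a multiple of ∂σ kills the coefficient of τ without changing the homology class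
      c₁ = c ++ scale m (∂Cube σ)
      c₂ = remove τ c₁

      c₁τ≡0 : coeff c₁ τ ≡ 0ℤ
      c₁τ≡0 = begin
        coeff c₁ τ                                 ≡⟨ coeff-++ c (scale m (∂Cube σ)) τ ⟩
        a + coeff (scale m (∂Cube σ)) τ            ≡⟨ cong (a +_) (coeff-scale m (∂Cube σ) τ) ⟩
        a + - (a * u) * u                          ≡⟨ regroup a u ⟩
        a - a * (u * u)                            ≡⟨ cong (λ x → a - a * x) u*u≡1 ⟩
        a - a * 1ℤ                                 ≡⟨ cancel a ⟩
        0ℤ                                         ∎
        where
        regroup : ∀ a u → a + - (a * u) * u ≡ a - a * (u * u)
        regroup = solve-∀
        cancel : ∀ a → a - a * 1ℤ ≡ 0ℤ
        cancel = solve-∀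

      c₂≈c₁ : c₂ ≈ c₁
      c₂≈c₁ = remove-≈ τ c₁ c₁τ≡0

      c₁-in-K : SupportedIn K (dim τ) c₁
      c₁-in-K = All.++⁺ c-in-K (All.map⁺ (All.map facet-in-K (∂Cube-facets σ)))
        where
        facet-in-K : ∀ {Q} → Facet Q σ → K Q × dim Q ≡ dim τ
        facet-in-K (Q⊑σ , dim≡) = closed Kσ Q⊑σ , ℕ.suc-injective (trans (sym dim≡) dimσ)

      c₂-in-K′ : SupportedIn (Without K τ σ) (dim τ) c₂
      c₂-in-K′ = All.map (λ ((KP , dimP) , P≢τ) → (KP , P≢τ , facet-dim-≢σ dimP) , dimP) (All-remove τ c₁ c₁-in-K)

      c₂-cycle : IsCycle c₂
      c₂-cycle Q = trans (∂-resp-≈ c₂ c₁ c₂≈c₁ Q) (IsCycle-+∂ c m σ c-cycle Q)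

      lift : (∃ λ d₂ → SupportedIn (Without K τ σ) (suc (dim τ)) d₂ × ∂ d₂ ≈ c₂) →
             ∃ λ d → SupportedIn K (suc (dim τ)) d × ∂ d ≈ c
      lift (d₂ , d₂-in-K′ , ∂d₂≈c₂) =
        d₂ ++ (a * u , σ) ∷ [] ,
        All.++⁺ (supported-mono proj₁ d₂-in-K′) ((Kσ , dimσ) ∷ []) ,
        ∂-add-cube d₂ c (a * u) σ (λ Q → trans (∂d₂≈c₂ Q) (c₂≈c₁ Q))

    fill-coface-dimension : HomologyTrivial (Without K τ σ) (dim σ) → HomologyTrivial K (dim σ)
    fill-coface-dimension trivial′ c c-in-K c-cycle =
      let (d , d-in-K′ , ∂d≈c₂) = trivial′ c₂ c₂-in-K′ c₂-cycle
      in d , supported-mono proj₁ d-in-K′ , λ Q → trans (∂d≈c₂ Q) (c₂≈c Q)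
      where
      open ≡-Reasoning
      c₂ = remove σ c

      -- τ is a free facet, so among the cubes of c only σ has τ in its boundary
      rest-misses-τ : coeff (∂ c₂) τ ≡ 0ℤ
      rest-misses-τ = LinearExtension.vanishes-on-support (∂-linear τ) c₂
        (All.map (λ ((KP , dimP) , P≢σ) → coeff-∂Cube-nonface _ τ (λ τ⊑P → [ coface-dim-≢τ dimP , P≢σ ]′ (free KP τ⊑P)))
                 (All-remove σ c c-in-K))

      cσ≡0 : coeff c σ ≡ 0ℤ
      cσ≡0 = begin
        coeff c σ                                 ≡⟨ sym (*-identityʳ (coeff c σ)) ⟩
        coeff c σ * 1ℤ                            ≡⟨ cong (coeff c σ *_) (sym u*u≡1) ⟩
        coeff c σ * (u * u)                       ≡⟨ sym (*-assoc (coeff c σ) u u) ⟩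
        coeff c σ * u * u                         ≡⟨ cong (_* u) (sym (+-identityʳ (coeff c σ * u))) ⟩
        (coeff c σ * u + 0ℤ) * u                  ≡⟨ cong (λ x → (coeff c σ * u + x) * u) (sym rest-misses-τ) ⟩
        (coeff c σ * u + coeff (∂ c₂) τ) * u      ≡⟨ cong (_* u) (sym (LinearExtension.split-at (∂-linear τ) σ c)) ⟩
        coeff (∂ c) τ * u                         ≡⟨ cong (_* u) (c-cycle τ) ⟩
        0ℤ * u                                    ≡⟨ *-zeroˡ u ⟩
        0ℤ                                        ∎

      c₂≈c : c₂ ≈ c
      c₂≈c = remove-≈ σ c cσ≡0

      c₂-in-K′ : SupportedIn (Without K τ σ) (dim σ) c₂
      c₂-in-K′ = All.map (λ ((KP , dimP) , P≢σ) → (KP , coface-dim-≢τ dimP , P≢σ) , dimP) (All-remove σ c c-in-K)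

      c₂-cycle : IsCycle c₂
      c₂-cycle Q = trans (∂-resp-≈ c₂ c c₂≈c Q) (c-cycle Q)

    fill-other-dimension : ∀ {k} → k ≢ dim τ → k ≢ dim σ → HomologyTrivial (Without K τ σ) k → HomologyTrivial K k
    fill-other-dimension k≢dimτ k≢dimσ trivial′ c c-in-K c-cycle =
      let (d , d-in-K′ , ∂d≈c) = trivial′ c (All.map (λ (KP , dimP) → (KP , avoids k≢dimτ dimP , avoids k≢dimσ dimP) , dimP) c-in-K) c-cycle
      in d , supported-mono proj₁ d-in-K′ , ∂d≈c
      where
      avoids : ∀ {k R P} → k ≢ dim R → dim P ≡ k → P ≢ R
      avoids k≢dimR dimP refl = k≢dimR (sym dimP)

    higher-homology-trivial : HigherHomologyTrivial (Without K τ σ) → HigherHomologyTrivial K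
    higher-homology-trivial trivial′ k 1≤k with k ℕ.≟ dim τ | k ℕ.≟ dim σ
    ... | yes refl | _        = fill-facet-dimension (trivial′ k 1≤k)
    ... | no _     | yes refl = fill-coface-dimension (trivial′ k 1≤k)
    ... | no k≢τ   | no k≢σ   = fill-other-dimension k≢τ k≢σ (trivial′ k 1≤k)

    acyclicOrEmpty : AcyclicOrEmpty (Without K τ σ) → AcyclicOrEmpty K
    acyclicOrEmpty (connected′ , trivial′) = connected connected′ , higher-homology-trivial trivial′

  record RankedPair (n : ℕ) : Set where
    constructor rankedPair
    field
      lower upper : Cube n
      rank        : ℕ

  open RankedPair public

  _≟ᴾ_ : DecidableEquality (RankedPair n)
  rankedPair τ σ r ≟ᴾ rankedPair τ′ σ′ r′ =
    map′ (λ { (refl , refl , refl) → refl }) (λ { refl → refl , refl , refl }) (τ ≟C τ′ ×-dec σ ≟C σ′ ×-dec r ℕ.≟ r′)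

  infix 4 _∈ᴾ_

  _∈ᴾ_ : Cube n → RankedPair n → Set
  Q ∈ᴾ p = Q ≡ lower p ⊎ Q ≡ upper p

  record IsRankedMatching (K : CubeSet n) (ps : List (RankedPair n)) : Set where
    field
      facet-pair   : ∀ {p} → p ∈ ps → K (lower p) × K (upper p) × Facet (lower p) (upper p)
      coface-lower : ∀ {p} → p ∈ ps → ∀ {P} → K P → lower p ⊑ P → P ≢ lower p → P ≢ upper p →
                     ∃ λ q → q ∈ ps × P ∈ᴾ q × rank q < rank p
      disjoint     : ∀ {p q} → p ∈ ps → q ∈ ps → ∀ {Q} → Q ∈ᴾ p → Q ∈ᴾ q → p ≡ q

  Unmatched : CubeSet n → List (RankedPair n) → CubeSet n
  Unmatched K ps Q = K Q × (∀ {p} → p ∈ ps → ¬ Q ∈ᴾ p)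

  minimal-rank : ∀ (p₀ : RankedPair n) ps₀ → ∃ λ p → p ∈ p₀ ∷ ps₀ × (∀ {q} → q ∈ p₀ ∷ ps₀ → rank p ≤ rank q)
  minimal-rank p₀ ps₀ =
    argmin rank p₀ ps₀ ,
    [ here , there ]′ (argmin-sel rank p₀ ps₀) ,
    λ { (here refl) → f[argmin]≤f[⊤] {f = rank} p₀ ps₀ ; (there q∈ps₀) → All.lookup (f[argmin]≤f[xs] {f = rank} p₀ ps₀) q∈ps₀ }

  module RemoveMinimalPair {K : CubeSet n} {ps : List (RankedPair n)}
    (closed : FaceClosed K) (matching : IsRankedMatching K ps)
    {p : RankedPair n} (p∈ps : p ∈ ps) (minimal : ∀ {q} → q ∈ ps → rank p ≤ rank q) where

    open IsRankedMatching matching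

    τ = lower p
    σ = upper p
    Kσ = proj₁ (proj₂ (facet-pair p∈ps))
    τ⋖σ = proj₂ (proj₂ (facet-pair p∈ps))
    K′ = Without K τ σ
    ps′ = filter (λ q → ¬? (q ≟ᴾ p)) ps

    private
      ∉p : ∀ {Q} → K′ Q → ¬ Q ∈ᴾ p
      ∉p (_ , Q≢τ , Q≢σ) = [ Q≢τ , Q≢σ ]′

      ∈ps′⁻ : ∀ {q} → q ∈ ps′ → q ∈ ps × q ≢ p
      ∈ps′⁻ = ∈-filter⁻ (λ q → ¬? (q ≟ᴾ p))

      ∈ps′⁺ : ∀ {q} → q ∈ ps → q ≢ p → q ∈ ps′
      ∈ps′⁺ = ∈-filter⁺ (λ q → ¬? (q ≟ᴾ p))

    free : FreeFacet K τ σ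
    free {P} KP τ⊑P with P ≟C τ | P ≟C σ
    ... | yes P≡τ | _       = inj₁ P≡τ
    ... | no _    | yes P≡σ = inj₂ P≡σ
    ... | no P≢τ  | no P≢σ  =
      let (q , q∈ps , _ , rank<) = coface-lower p∈ps KP τ⊑P P≢τ P≢σ
      in ⊥-elim (ℕ.<⇒≱ rank< (minimal q∈ps))

    length-ps′ : length ps′ < length ps
    length-ps′ = filter-notAll (λ q → ¬? (q ≟ᴾ p)) ps (Any.map (λ p≡q q≢p → q≢p (sym p≡q)) p∈ps)

    closed′ : FaceClosed K′
    closed′ {P} (KP , P≢τ , P≢σ) Q⊑P = closed KP Q⊑P , Q≢τ , Q≢σ
      where
      not-τ-or-σ : ¬ P ∈ᴾ p
      not-τ-or-σ = [ P≢τ , P≢σ ]′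
      Q≢τ : _ ≢ τ
      Q≢τ refl = not-τ-or-σ (free KP Q⊑P)
      Q≢σ : _ ≢ σ
      Q≢σ refl = not-τ-or-σ (free KP (⊑-trans (proj₁ τ⋖σ) Q⊑P))

    matching′ : IsRankedMatching K′ ps′
    matching′ = record
      { facet-pair   = facet-pair′
      ; coface-lower = coface-lower′
      ; disjoint     = λ q∈ps′ r∈ps′ → disjoint (proj₁ (∈ps′⁻ q∈ps′)) (proj₁ (∈ps′⁻ r∈ps′))
      }
      where
      facet-pair′ : ∀ {q} → q ∈ ps′ → K′ (lower q) × K′ (upper q) × Facet (lower q) (upper q)
      facet-pair′ {q} q∈ps′ = (Kτq , avoids-p (inj₁ refl)) , (Kσq , avoids-p (inj₂ refl)) , τq⋖σq
        where
        q∈ps = proj₁ (∈ps′⁻ q∈ps′)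
        q≢p = proj₂ (∈ps′⁻ q∈ps′)
        Kτq = proj₁ (facet-pair q∈ps)
        Kσq = proj₁ (proj₂ (facet-pair q∈ps))
        τq⋖σq = proj₂ (proj₂ (facet-pair q∈ps))
        avoids-p : ∀ {Q} → Q ∈ᴾ q → Q ≢ τ × Q ≢ σ
        avoids-p Q∈q = (λ Q≡τ → q≢p (disjoint q∈ps p∈ps Q∈q (inj₁ Q≡τ))) , (λ Q≡σ → q≢p (disjoint q∈ps p∈ps Q∈q (inj₂ Q≡σ)))

      coface-lower′ : ∀ {q} → q ∈ ps′ → ∀ {P} → K′ P → lower q ⊑ P → P ≢ lower q → P ≢ upper q →
                      ∃ λ q′ → q′ ∈ ps′ × P ∈ᴾ q′ × rank q′ < rank q
      coface-lower′ q∈ps′ K′P τq⊑P P≢τq P≢σq =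
        let (q′ , q′∈ps , P∈q′ , rank<) = coface-lower (proj₁ (∈ps′⁻ q∈ps′)) (proj₁ K′P) τq⊑P P≢τq P≢σq
        in q′ , ∈ps′⁺ q′∈ps (λ q′≡p → ∉p K′P (subst (_ ∈ᴾ_) q′≡p P∈q′)) , P∈q′ , rank<

    unmatched⊆ : Unmatched K ps ⊆ Unmatched K′ ps′
    unmatched⊆ (KQ , unmatched) =
      (KQ , (λ Q≡τ → unmatched p∈ps (inj₁ Q≡τ)) , (λ Q≡σ → unmatched p∈ps (inj₂ Q≡σ))) ,
      λ q∈ps′ → unmatched (proj₁ (∈ps′⁻ q∈ps′))

    unmatched⊇ : Unmatched K′ ps′ ⊆ Unmatched K ps
    unmatched⊇ {Q} (K′Q , unmatched′) = proj₁ K′Q , not-in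
      where
      not-in : ∀ {q} → q ∈ ps → ¬ Q ∈ᴾ q
      not-in {q} q∈ps with q ≟ᴾ p
      ... | yes refl = ∉p K′Q
      ... | no q≢p   = unmatched′ (∈ps′⁺ q∈ps q≢p)

  acyclicOrEmpty-by-matching : ∀ {K : CubeSet n} {ps} → FaceClosed K → IsRankedMatching K ps →
    AcyclicOrEmpty (Unmatched K ps) → AcyclicOrEmpty K
  acyclicOrEmpty-by-matching {ps = ps} = go (length ps) ℕ.≤-refl
    where
    go : ∀ {K : CubeSet n} {ps} fuel → length ps ≤ fuel → FaceClosed K → IsRankedMatching K ps →
         AcyclicOrEmpty (Unmatched K ps) → AcyclicOrEmpty K
    go {ps = []} _ _ _ _ = AcyclicOrEmpty-≐ proj₁ (λ KQ → KQ , λ ())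
    go {K = K} {ps = p₀ ∷ ps₀} (suc fuel) (s≤s length≤) closed matching unmatched-acyclic =
      ElementaryCollapse.acyclicOrEmpty closed Kσ τ⋖σ free
        (go fuel (ℕ.≤-pred (ℕ.≤-trans length-ps′ (s≤s length≤))) closed′ matching′
          (AcyclicOrEmpty-≐ unmatched⊆ unmatched⊇ unmatched-acyclic))
      where
      p-minimal = minimal-rank p₀ ps₀
      open RemoveMinimalPair closed matching (proj₁ (proj₂ p-minimal)) (proj₂ (proj₂ p-minimal))

  point-acyclicOrEmpty : ∀ {K : CubeSet n} v → dim v ≡ 0 → (∀ {Q} → K Q → Q ≡ v) → AcyclicOrEmpty K
  point-acyclicOrEmpty {K = K} v dimv only-v = connected , trivial
    where
    connected : Connected K
    connected a b Ka Kb _ _ rewrite only-v Ka | only-v Kb = ε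
    trivial : HigherHomologyTrivial K
    trivial k 1≤k [] [] _ = [] , [] , λ _ → refl
    trivial k 1≤k ((_ , P) ∷ _) ((KP , refl) ∷ _) _ with () ← ℕ.<⇒≢ 1≤k (sym (trans (cong dim (only-v KP)) dimv))

module Realization where

  open Boundary using (Facet; ⊑-refl)
  open import Data.Nat as ℕ using (ℕ; zero; suc)
  import Data.Nat.Properties as ℕ
  open import Data.Bool using (Bool; true; false; f≤t; b≤b) renaming (_≤_ to _≤ᵇ_)
  open import Data.Bool.Properties using (∨-identityʳ)
  open import Data.Fin using (zero; suc)
  open import Data.Vec using ([]; _∷_; here; there)
  open import Data.Vec.Relation.Binary.Pointwise.Inductive using ([]; _∷_)
  open import Data.Fin.Subset using (Subset; ⁅_⁆; _⊆_; _∪_) renaming (⊥ to ∅; _∈_ to _∈ₛ_; _∉_ to _∉ₛ_)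
  open import Data.Fin.Subset.Properties using (drop-∷-⊆; ⊆-antisym; out⊆; s⊆s; ∪-identityʳ)
  open import Data.Product using (∃₂; _×_; _,_)
  open import Relation.Binary.PropositionalEquality
  open import Data.Empty using (⊥-elim)
  open import Function using (_∘_)

  private variable
    n : ℕ
    c d : Bool
    C D : Subset n

  ∷-⊆ : c ≤ᵇ d → C ⊆ D → c ∷ C ⊆ d ∷ D
  ∷-⊆ f≤t = out⊆
  ∷-⊆ b≤b = s⊆s

  head-⊆ : c ∷ C ⊆ d ∷ D → c ≤ᵇ d
  head-⊆ {c = false} {d = false} _ = b≤b
  head-⊆ {c = false} {d = true}  _ = f≤t
  head-⊆ {c = true}  {d = true}  _ = b≤b
  head-⊆ {c = true}  {d = false} c∷C⊆d∷D with c∷C⊆d∷D here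
  ... | ()

  face-of-realI : ∀ {a b q} → a ≤ᵇ b → q ⊑I realI a b → ∃₂ λ c d → q ≡ realI c d × a ≤ᵇ c × c ≤ᵇ d × d ≤ᵇ b
  face-of-realI {true}  b≤b same         = true  , true  , refl , b≤b , b≤b , b≤b
  face-of-realI {false} b≤b same         = false , false , refl , b≤b , b≤b , b≤b
  face-of-realI         f≤t same         = false , true  , refl , b≤b , f≤t , b≤b
  face-of-realI         f≤t left         = false , false , refl , b≤b , b≤b , f≤t
  face-of-realI         f≤t (right refl) = true  , true  , refl , f≤t , b≤b , b≤b

  face-of-real : ∀ {A B : Subset n} {Q} → A ⊆ B → Q ⊑ real A B → ∃₂ λ C D → Q ≡ real C D × A ⊆ C × C ⊆ D × D ⊆ B
  face-of-real {A = []} {[]} _ [] = [] , [] , refl , (λ ()) , (λ ()) , (λ ())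
  face-of-real {A = a ∷ A} {b ∷ B} A⊆B (q⊑ ∷ Q⊑) =
    let (c , d , q≡ , a≤c , c≤d , d≤b) = face-of-realI (head-⊆ A⊆B) q⊑
        (C , D , Q≡ , A⊆C , C⊆D , D⊆B) = face-of-real (drop-∷-⊆ A⊆B) Q⊑
    in c ∷ C , d ∷ D , cong₂ _∷_ q≡ Q≡ , ∷-⊆ a≤c A⊆C , ∷-⊆ c≤d C⊆D , ∷-⊆ d≤b D⊆B

  realI-⊑I-realI : ∀ {c d c′ d′} → c ≤ᵇ d → c′ ≤ᵇ d′ → realI c d ⊑I realI c′ d′ → c′ ≤ᵇ c × d ≤ᵇ d′
  realI-⊑I-realI {true}  {true}  {true}  {true}  _ _ same         = b≤b , b≤b
  realI-⊑I-realI {true}  {true}  {false} {true}  _ _ (right refl) = f≤t , b≤b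
  realI-⊑I-realI {false} {true}  {false} {true}  _ _ same         = b≤b , b≤b
  realI-⊑I-realI {false} {false} {false} {true}  _ _ left         = b≤b , f≤t
  realI-⊑I-realI {false} {false} {false} {false} _ _ same         = b≤b , b≤b

  real-⊑-real : ∀ {C D C′ D′ : Subset n} → C ⊆ D → C′ ⊆ D′ → real C D ⊑ real C′ D′ → C′ ⊆ C × D ⊆ D′
  real-⊑-real {C = []} {[]} {[]} {[]} _ _ [] = (λ ()) , (λ ())
  real-⊑-real {C = c ∷ C} {d ∷ D} {c′ ∷ C′} {d′ ∷ D′} C⊆D C′⊆D′ (⊑I ∷ ⊑) =
    let (c′≤c , d≤d′) = realI-⊑I-realI (head-⊆ C⊆D) (head-⊆ C′⊆D′) ⊑I
        (C′⊆C , D⊆D′) = real-⊑-real (drop-∷-⊆ C⊆D) (drop-∷-⊆ C′⊆D′) ⊑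
    in ∷-⊆ c′≤c C′⊆C , ∷-⊆ d≤d′ D⊆D′

  real-injective : ∀ {C D C′ D′ : Subset n} → C ⊆ D → C′ ⊆ D′ → real C D ≡ real C′ D′ → C ≡ C′ × D ≡ D′
  real-injective C⊆D C′⊆D′ real≡ =
    let (C′⊆C , D⊆D′) = real-⊑-real C⊆D C′⊆D′ (subst (_ ⊑_) real≡ ⊑-refl)
        (C⊆C′ , D′⊆D) = real-⊑-real C′⊆D′ C⊆D (subst (_⊑ _) real≡ ⊑-refl)
    in ⊆-antisym C⊆C′ C′⊆C , ⊆-antisym D⊆D′ D′⊆D

  real-facet : ∀ {C D : Subset n} {j} → j ∈ₛ D → j ∉ₛ C → Facet (real (C ∪ ⁅ j ⁆) D) (real C D)
  real-facet {C = true  ∷ C} {true ∷ D} {zero} here j∉C = ⊥-elim (j∉C here)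
  real-facet {C = false ∷ C} {true ∷ D} {zero} here _ rewrite ∪-identityʳ C = right refl ∷ ⊑-refl , refl
  real-facet {C = c ∷ C} {d ∷ D} {suc j} (there j∈D) j∉c∷C rewrite ∨-identityʳ c =
    let (⊑ , dim≡) = real-facet {C = C} {D} j∈D (j∉c∷C ∘ there)
    in same ∷ ⊑ , trans (cong (dimI (realI c d) ℕ.+_) dim≡) (ℕ.+-suc (dimI (realI c d)) _)

  dim-real-∅ : dim (real {n} ∅ ∅) ≡ 0
  dim-real-∅ {zero}  = refl
  dim-real-∅ {suc n} = dim-real-∅ {n}

module SubsetLemmas where

  open import Data.Nat as ℕ using (ℕ; zero; suc; s≤s; _<_)
  open import Data.Bool using (true; false)
  open import Data.Fin using (Fin; zero; suc) renaming (_≟_ to _≟ᶠ_)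
  open import Data.Vec using ([]; _∷_; here; there)
  open import Data.List using (List; []; _∷_; _++_; map)
  open import Data.List.Membership.Propositional using () renaming (_∈_ to _∈ˡ_)
  open import Data.List.Membership.Propositional.Properties using (∈-++⁺ˡ; ∈-++⁺ʳ; ∈-map⁺)
  open import Data.List.Relation.Unary.Any using (here)
  open import Data.Fin.Subset using (Subset; ⁅_⁆; _⊆_; _∪_; _-_; Nonempty; ∣_∣) renaming (⊥ to ∅; _∈_ to _∈ₛ_; _∉_ to _∉ₛ_)
  open import Data.Fin.Subset.Properties using (drop-∷-⊆; ⊆-antisym; ⊥⊆; x∈p∪q⁻; x∈p∪q⁺; x∈⁅x⁆; x∈⁅y⁆⇒x≡y;
    x∈p∧x≢y⇒x∈p-y; p─q⊆p; p⊆q⇒∣p∣≤∣q∣; _∈?_)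
  open import Data.Product using (_×_; _,_; proj₁)
  open import Data.Sum using (_⊎_; inj₁; inj₂)
  open import Relation.Binary.PropositionalEquality
  open import Relation.Nullary using (yes; no)
  open import Data.Empty using (⊥-elim)
  open import Function using (_∘_)

  private variable
    n : ℕ
    p q : Subset n
    x y : Fin n

  p-x⊆p : ∀ (p : Subset n) x → p - x ⊆ p
  p-x⊆p p x = p─q⊆p p ⁅ x ⁆

  x∉p-x : ∀ (p : Subset n) x → x ∉ₛ p - x
  x∉p-x (true  ∷ p) zero ()
  x∉p-x (false ∷ p) zero ()
  x∉p-x (_ ∷ p) (suc x) (there x∈p-x) = x∉p-x p x x∈p-x

  x∈p-y⁻ : ∀ {p : Subset n} {x y} → x ∈ₛ p - y → x ∈ₛ p × x ≢ y
  x∈p-y⁻ {p = p} {y = y} x∈p-y = p-x⊆p p y x∈p-y , λ { refl → x∉p-x p y x∈p-y }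

  x∈p∪⁅y⁆⁻ : ∀ {p : Subset n} {x y} → x ∈ₛ p ∪ ⁅ y ⁆ → x ∈ₛ p ⊎ x ≡ y
  x∈p∪⁅y⁆⁻ {p = p} {y = y} x∈ with x∈p∪q⁻ p ⁅ y ⁆ x∈
  ... | inj₁ x∈p   = inj₁ x∈p
  ... | inj₂ x∈⁅y⁆ = inj₂ (x∈⁅y⁆⇒x≡y y x∈⁅y⁆)

  x∈p∪⁅y⁆⁺ : x ∈ₛ p ⊎ x ≡ y → x ∈ₛ p ∪ ⁅ y ⁆
  x∈p∪⁅y⁆⁺ (inj₁ x∈p)  = x∈p∪q⁺ (inj₁ x∈p)
  x∈p∪⁅y⁆⁺ (inj₂ refl) = x∈p∪q⁺ (inj₂ (x∈⁅x⁆ _))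

  p⊆p∪⁅x⁆ : p ⊆ p ∪ ⁅ x ⁆
  p⊆p∪⁅x⁆ x∈p = x∈p∪⁅y⁆⁺ (inj₁ x∈p)

  x∈p⇒⁅x⁆⊆p : x ∈ₛ p → ⁅ x ⁆ ⊆ p
  x∈p⇒⁅x⁆⊆p {x = x} x∈p y∈⁅x⁆ rewrite x∈⁅y⁆⇒x≡y x y∈⁅x⁆ = x∈p

  p⊆q∧x∉p⇒p⊆q-x : p ⊆ q → x ∉ₛ p → p ⊆ q - x
  p⊆q∧x∉p⇒p⊆q-x p⊆q x∉p y∈p = x∈p∧x≢y⇒x∈p-y (p⊆q y∈p) (λ { refl → x∉p y∈p })

  x∉p⇒p-x≡p : ∀ {p : Subset n} {x} → x ∉ₛ p → p - x ≡ p
  x∉p⇒p-x≡p {p = p} {x} x∉p = ⊆-antisym (p-x⊆p p x) (p⊆q∧x∉p⇒p⊆q-x (λ y∈p → y∈p) x∉p)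

  x∉p⇒p∪⁅x⁆-x≡p : ∀ {p : Subset n} {x} → x ∉ₛ p → (p ∪ ⁅ x ⁆) - x ≡ p
  x∉p⇒p∪⁅x⁆-x≡p {p = p} {x} x∉p = ⊆-antisym ⊆p (p⊆q∧x∉p⇒p⊆q-x p⊆p∪⁅x⁆ x∉p)
    where
    ⊆p : (p ∪ ⁅ x ⁆) - x ⊆ p
    ⊆p y∈ with x∈p-y⁻ y∈
    ... | y∈p∪⁅x⁆ , y≢x with x∈p∪⁅y⁆⁻ y∈p∪⁅x⁆
    ...   | inj₁ y∈p = y∈p
    ...   | inj₂ y≡x = ⊥-elim (y≢x y≡x)

  x∈p⇒p-x∪⁅x⁆≡p : ∀ {p : Subset n} {x} → x ∈ₛ p → (p - x) ∪ ⁅ x ⁆ ≡ p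
  x∈p⇒p-x∪⁅x⁆≡p {p = p} {x} x∈p = ⊆-antisym ⊆p ⊇p
    where
    ⊆p : (p - x) ∪ ⁅ x ⁆ ⊆ p
    ⊆p y∈ with x∈p∪⁅y⁆⁻ y∈
    ... | inj₁ y∈p-x = proj₁ (x∈p-y⁻ y∈p-x)
    ... | inj₂ refl  = x∈p
    ⊇p : p ⊆ (p - x) ∪ ⁅ x ⁆
    ⊇p {y} y∈p with y ≟ᶠ x
    ... | yes y≡x = x∈p∪⁅y⁆⁺ (inj₂ y≡x)
    ... | no y≢x  = x∈p∪⁅y⁆⁺ (inj₁ (x∈p∧x≢y⇒x∈p-y y∈p y≢x))

  p⊆∅⇒p≡∅ : p ⊆ ∅ → p ≡ ∅
  p⊆∅⇒p≡∅ p⊆∅ = ⊆-antisym p⊆∅ ⊥⊆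

  Nonempty-mono : p ⊆ q → Nonempty p → Nonempty q
  Nonempty-mono p⊆q (x , x∈p) = x , p⊆q x∈p

  p⊆q∧p≢q⇒∣p∣<∣q∣ : ∀ {p q : Subset n} → p ⊆ q → p ≢ q → ∣ p ∣ < ∣ q ∣
  p⊆q∧p≢q⇒∣p∣<∣q∣ {p = []}        {[]}        _   p≢q = ⊥-elim (p≢q refl)
  p⊆q∧p≢q⇒∣p∣<∣q∣ {p = true ∷ p}  {true ∷ q}  p⊆q p≢q = s≤s (p⊆q∧p≢q⇒∣p∣<∣q∣ (drop-∷-⊆ p⊆q) (p≢q ∘ cong (true ∷_)))
  p⊆q∧p≢q⇒∣p∣<∣q∣ {p = false ∷ p} {false ∷ q} p⊆q p≢q = p⊆q∧p≢q⇒∣p∣<∣q∣ (drop-∷-⊆ p⊆q) (p≢q ∘ cong (false ∷_))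
  p⊆q∧p≢q⇒∣p∣<∣q∣ {p = false ∷ p} {true ∷ q}  p⊆q _   = s≤s (p⊆q⇒∣p∣≤∣q∣ (drop-∷-⊆ p⊆q))
  p⊆q∧p≢q⇒∣p∣<∣q∣ {p = true ∷ p}  {false ∷ q} p⊆q _   with p⊆q here
  ... | ()

  allSubsets : ∀ n → List (Subset n)
  allSubsets zero    = [] ∷ []
  allSubsets (suc n) = map (true ∷_) (allSubsets n) ++ map (false ∷_) (allSubsets n)

  ∈-allSubsets : ∀ (p : Subset n) → p ∈ˡ allSubsets n
  ∈-allSubsets []          = here refl
  ∈-allSubsets (true  ∷ p) = ∈-++⁺ˡ (∈-map⁺ (true ∷_) (∈-allSubsets p))
  ∈-allSubsets {suc n} (false ∷ p) = ∈-++⁺ʳ (map (true ∷_) (allSubsets n)) (∈-map⁺ (false ∷_) (∈-allSubsets p))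

  p⊆q∪⁅x⁆⇒∣p-x∣<∣q∣ : ∀ {p q : Subset n} {x} → p ⊆ q ∪ ⁅ x ⁆ → x ∉ₛ q → p ≢ q ∪ ⁅ x ⁆ → p ≢ q → ∣ p - x ∣ < ∣ q ∣
  p⊆q∪⁅x⁆⇒∣p-x∣<∣q∣ {p = p} {q} {x} p⊆q∪x x∉q p≢q∪x p≢q = p⊆q∧p≢q⇒∣p∣<∣q∣ p-x⊆q p-x≢q
    where
    p-x⊆q : p - x ⊆ q
    p-x⊆q y∈p-x with x∈p-y⁻ y∈p-x
    ... | y∈p , y≢x with x∈p∪⁅y⁆⁻ (p⊆q∪x y∈p)
    ...   | inj₁ y∈q = y∈q
    ...   | inj₂ y≡x = ⊥-elim (y≢x y≡x)
    p-x≢q : p - x ≢ q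
    p-x≢q p-x≡q with x ∈? p
    ... | yes x∈p = p≢q∪x (trans (sym (x∈p⇒p-x∪⁅x⁆≡p x∈p)) (cong (_∪ ⁅ x ⁆) p-x≡q))
    ... | no x∉p  = p≢q (trans (sym (x∉p⇒p-x≡p x∉p)) p-x≡q)

module MixedRadix (N : ℕ) where

  open import Data.Nat
  open import Data.Nat.Properties

  encode : ℕ → ℕ → ℕ → ℕ
  encode a b c = (a * N + b) * N + c

  private
    carry : ∀ {x x′ y} → x′ < x → y < N → x′ * N + y < x * N
    carry {x} {x′} {y} x′<x y<N = begin-strict
      x′ * N + y   <⟨ +-monoʳ-< (x′ * N) y<N ⟩
      x′ * N + N   ≡⟨ +-comm (x′ * N) N ⟩
      suc x′ * N   ≤⟨ *-monoˡ-≤ N x′<x ⟩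
      x * N        ∎
      where open ≤-Reasoning

  encode-<₁ : ∀ {a a′ b b′ c c′} → a′ < a → b′ < N → c′ < N → encode a′ b′ c′ < encode a b c
  encode-<₁ {a} {a′} {b} {b′} {c} {c′} a′<a b′<N c′<N = begin-strict
    encode a′ b′ c′      <⟨ carry (<-≤-trans (carry a′<a b′<N) (m≤m+n (a * N) b)) c′<N ⟩
    (a * N + b) * N      ≤⟨ m≤m+n _ c ⟩
    encode a b c         ∎
    where open ≤-Reasoning

  encode-<₂ : ∀ a {b b′ c c′} → b′ < b → c′ < N → encode a b′ c′ < encode a b c
  encode-<₂ a {b} {b′} {c} b′<b c′<N = begin-strict
    encode a b′ _        <⟨ carry (+-monoʳ-< (a * N) b′<b) c′<N ⟩
    (a * N + b) * N      ≤⟨ m≤m+n _ c ⟩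
    encode a b c         ∎
    where open ≤-Reasoning

  encode-<₃ : ∀ a b {c c′} → c′ < c → encode a b c′ < encode a b c
  encode-<₃ a b c′<c = +-monoʳ-< ((a * N + b) * N) c′<c

module RootDescent {n : ℕ} (F : Family n) (rooted : SimplyRooted F) (∅∈F : ∅ ∈F F) (default : Fin n) where

  open SubsetLemmas
  open import Data.Nat as ℕ using (zero; suc; _≤_; _<_)
  import Data.Nat.Properties as ℕ
  open import Data.Bool using (true)
  import Data.Bool as Bool
  open import Data.Fin.Subset using (Subset; ⁅_⁆; _⊆_; _∪_; _-_; Nonempty; Empty; ∣_∣) renaming (_∈_ to _∈ₛ_; _∉_ to _∉ₛ_)
  open import Data.Fin.Subset.Properties using (⊆-refl; ⊆-trans; _∈?_; nonempty?; x∈p⇒∣p-x∣<∣p∣; p⊆q⇒∣p∣≤∣q∣)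
  open import Data.Product using (_×_; _,_; proj₁; proj₂)
  open import Data.Sum as Sum using (_⊎_; inj₁; inj₂)
  open import Relation.Binary.PropositionalEquality
  open import Relation.Nullary using (Dec; yes; no)
  open import Data.Empty using (⊥-elim)
  open import Function using (_∘_)

  -- off the nonempty members of F the root is the junk value `default`, the only use of n ≥ 1
  root : Subset n → Fin n
  root D with F D Bool.≟ true | nonempty? D
  ... | yes D∈F | yes D≢∅ = proj₁ (rooted D D∈F D≢∅)
  ... | _       | _       = default

  root-spec : ∀ {D} → D ∈F F → Nonempty D → root D ∈ₛ D × IntervalIn F ⁅ root D ⁆ D
  root-spec {D} D∈F D≢∅ with F D Bool.≟ true | nonempty? D
  ... | yes D∈F′ | yes D≢∅′ = proj₂ (rooted D D∈F′ D≢∅′)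
  ... | no D∉F   | _        = ⊥-elim (D∉F D∈F)
  ... | yes _    | no D≡∅   = ⊥-elim (D≡∅ D≢∅)

  pivot : Subset n → Fin n
  pivot T with nonempty? (T - root T)
  ... | yes (j , _) = j
  ... | no _        = root T

  pivot∈T-root : ∀ {T} → Nonempty (T - root T) → pivot T ∈ₛ T - root T
  pivot∈T-root {T} T-r≢∅ with nonempty? (T - root T)
  ... | yes (_ , j∈) = j∈
  ... | no T-r≡∅     = ⊥-elim (T-r≡∅ T-r≢∅)

  pivot≡root : ∀ {T} → Empty (T - root T) → pivot T ≡ root T
  pivot≡root {T} T-r≡∅ with nonempty? (T - root T)
  ... | yes T-r≢∅ = ⊥-elim (T-r≡∅ T-r≢∅)
  ... | no _      = refl

  pivot∈ : ∀ {T} → T ∈F F → Nonempty T → pivot T ∈ₛ T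
  pivot∈ {T} T∈F T≢∅ = by-cases (nonempty? (T - root T))
    where
    by-cases : Dec (Nonempty (T - root T)) → pivot T ∈ₛ T
    by-cases (yes T-r≢∅) = proj₁ (x∈p-y⁻ (pivot∈T-root T-r≢∅))
    by-cases (no T-r≡∅)  = subst (_∈ₛ T) (sym (pivot≡root T-r≡∅)) (proj₁ (root-spec T∈F T≢∅))

  pivot≢root : ∀ {T} → Nonempty (T - root T) → pivot T ≢ root T
  pivot≢root T-r≢∅ = proj₂ (x∈p-y⁻ (pivot∈T-root T-r≢∅))

  data Descent (C : Subset n) : Subset n → Subset n → Set where
    bottom  : ∀ {D} → D ∈F F → Nonempty D → Empty (D - root D) → Descent C D D
    blocked : ∀ {D} → D ∈F F → Nonempty D → Nonempty (D - root D) → root D ∈ₛ C → Descent C D D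
    step    : ∀ {D T} → D ∈F F → Nonempty D → Nonempty (D - root D) → root D ∉ₛ C →
              Descent C (D - root D) T → Descent C D T

  module _ {C : Subset n} where

    Descent-⊆ : ∀ {D T} → Descent C D T → T ⊆ D
    Descent-⊆ (bottom _ _ _)         = ⊆-refl
    Descent-⊆ (blocked _ _ _ _)      = ⊆-refl
    Descent-⊆ {D} (step _ _ _ _ rest) = ⊆-trans (Descent-⊆ rest) (p-x⊆p D (root D))

    Descent-end : ∀ {D T} → Descent C D T → T ∈F F × Nonempty T
    Descent-end (bottom T∈F T≢∅ _)    = T∈F , T≢∅
    Descent-end (blocked T∈F T≢∅ _ _) = T∈F , T≢∅
    Descent-end (step _ _ _ _ rest)   = Descent-end rest

    Descent-C⊆ : ∀ {D T} → Descent C D T → C ⊆ D → C ⊆ T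
    Descent-C⊆ (bottom _ _ _)           C⊆D = C⊆D
    Descent-C⊆ (blocked _ _ _ _)        C⊆D = C⊆D
    Descent-C⊆ (step _ _ _ r∉C rest)    C⊆D = Descent-C⊆ rest (p⊆q∧x∉p⇒p⊆q-x C⊆D r∉C)

    Descent-stop : ∀ {D T} → Descent C D T → Empty (T - root T) ⊎ (Nonempty (T - root T) × root T ∈ₛ C)
    Descent-stop (bottom _ _ T-r≡∅)        = inj₁ T-r≡∅
    Descent-stop (blocked _ _ T-r≢∅ r∈C)   = inj₂ (T-r≢∅ , r∈C)
    Descent-stop (step _ _ _ _ rest)       = Descent-stop rest

    Descent-pivot∈ : ∀ {D T} → Descent C D T → pivot T ∈ₛ T
    Descent-pivot∈ d = let (T∈F , T≢∅) = Descent-end d in pivot∈ T∈F T≢∅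

  Descent-deterministic : ∀ {C D T T′} → Descent C D T → Descent C D T′ → T ≡ T′
  Descent-deterministic (bottom _ _ _)       (bottom _ _ _)       = refl
  Descent-deterministic (bottom _ _ T-r≡∅)   (blocked _ _ T-r≢∅ _) = ⊥-elim (T-r≡∅ T-r≢∅)
  Descent-deterministic (bottom _ _ T-r≡∅)   (step _ _ T-r≢∅ _ _) = ⊥-elim (T-r≡∅ T-r≢∅)
  Descent-deterministic (blocked _ _ T-r≢∅ _) (bottom _ _ T-r≡∅)  = ⊥-elim (T-r≡∅ T-r≢∅)
  Descent-deterministic (blocked _ _ _ _)    (blocked _ _ _ _)    = refl
  Descent-deterministic (blocked _ _ _ r∈C)  (step _ _ _ r∉C _)   = ⊥-elim (r∉C r∈C)
  Descent-deterministic (step _ _ T-r≢∅ _ _) (bottom _ _ T-r≡∅)   = ⊥-elim (T-r≡∅ T-r≢∅)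
  Descent-deterministic (step _ _ _ r∉C _)   (blocked _ _ _ r∈C)  = ⊥-elim (r∉C r∈C)
  Descent-deterministic (step _ _ _ _ rest)  (step _ _ _ _ rest′) = Descent-deterministic rest rest′

  Descent-toggle-pivot : ∀ {C C′ D T} → Descent C D T →
    (∀ {x} → x ≢ pivot T → x ∈ₛ C′ → x ∈ₛ C) → (∀ {x} → x ≢ pivot T → x ∈ₛ C → x ∈ₛ C′) → Descent C′ D T
  Descent-toggle-pivot (bottom D∈F D≢∅ D-r≡∅) _ _ = bottom D∈F D≢∅ D-r≡∅
  Descent-toggle-pivot (blocked D∈F D≢∅ D-r≢∅ r∈C) _ C⊆C′ = blocked D∈F D≢∅ D-r≢∅ (C⊆C′ (pivot≢root D-r≢∅ ∘ sym) r∈C)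
  Descent-toggle-pivot {D = D} (step D∈F D≢∅ D-r≢∅ r∉C rest) C′⊆C C⊆C′ =
    step D∈F D≢∅ D-r≢∅ (r∉C ∘ C′⊆C r≢pivot) (Descent-toggle-pivot rest C′⊆C C⊆C′)
    where
    r≢pivot : root D ≢ pivot _
    r≢pivot r≡j = proj₂ (x∈p-y⁻ (Descent-⊆ rest (Descent-pivot∈ rest))) (sym r≡j)

  Descent-shrinks : ∀ {C C′ D T T′} → Descent C D T → C′ ⊆ C ∪ ⁅ pivot T ⁆ → Descent C′ D T′ → ∣ T′ ∣ < ∣ T ∣ ⊎ T′ ≡ T
  Descent-shrinks (bottom _ _ _)          _ (bottom _ _ _)          = inj₂ refl
  Descent-shrinks (bottom _ _ D-r≡∅)      _ (blocked _ _ D-r≢∅ _)   = ⊥-elim (D-r≡∅ D-r≢∅)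
  Descent-shrinks (bottom _ _ D-r≡∅)      _ (step _ _ D-r≢∅ _ _)    = ⊥-elim (D-r≡∅ D-r≢∅)
  Descent-shrinks (blocked _ _ D-r≢∅ _)   _ (bottom _ _ D-r≡∅)      = ⊥-elim (D-r≡∅ D-r≢∅)
  Descent-shrinks (blocked _ _ _ _)       _ (blocked _ _ _ _)       = inj₂ refl
  Descent-shrinks (blocked D∈F D≢∅ _ _)   _ (step _ _ _ _ rest′)    =
    inj₁ (ℕ.≤-<-trans (p⊆q⇒∣p∣≤∣q∣ (Descent-⊆ rest′)) (x∈p⇒∣p-x∣<∣p∣ (proj₁ (root-spec D∈F D≢∅))))
  Descent-shrinks (step _ _ D-r≢∅ _ _)    _ (bottom _ _ D-r≡∅)      = ⊥-elim (D-r≡∅ D-r≢∅)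
  Descent-shrinks (step _ _ _ r∉C rest)   C′⊆C∪j (blocked _ _ _ r∈C′) with x∈p∪⁅y⁆⁻ (C′⊆C∪j r∈C′)
  ... | inj₁ r∈C   = ⊥-elim (r∉C r∈C)
  ... | inj₂ r≡j   = ⊥-elim (proj₂ (x∈p-y⁻ (Descent-⊆ rest (Descent-pivot∈ rest))) (sym r≡j))
  Descent-shrinks (step _ _ _ _ rest)     C′⊆C∪j (step _ _ _ _ rest′) = Descent-shrinks rest C′⊆C∪j rest′

  descend : ℕ → Subset n → Subset n → Subset n
  descend zero       C D = D
  descend (suc fuel) C D with nonempty? (D - root D)
  ... | no _ = D
  ... | yes _ with root D ∈? C
  ...   | yes _ = D
  ...   | no _  = descend fuel C (D - root D)

  descend-sound : ∀ fuel {C D} → ∣ D ∣ ≤ fuel → C ⊆ D → IntervalIn F C D → Nonempty D → Descent C D (descend fuel C D)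
  descend-sound zero ∣D∣≤0 _ _ (_ , x∈D) with () ← ℕ.≤-trans (x∈p⇒∣p-x∣<∣p∣ x∈D) ∣D∣≤0
  descend-sound (suc fuel) {C} {D} ∣D∣≤ C⊆D [C,D]⊆F D≢∅ with nonempty? (D - root D)
  ... | no D-r≡∅ = bottom D∈F D≢∅ D-r≡∅
    where D∈F = [C,D]⊆F D C⊆D ⊆-refl
  ... | yes D-r≢∅ with root D ∈? C
  ...   | yes r∈C = blocked ([C,D]⊆F D C⊆D ⊆-refl) D≢∅ D-r≢∅ r∈C
  ...   | no r∉C  = step D∈F D≢∅ D-r≢∅ r∉C
            (descend-sound fuel (ℕ.≤-pred (ℕ.≤-trans (x∈p⇒∣p-x∣<∣p∣ (proj₁ (root-spec D∈F D≢∅))) ∣D∣≤))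
               (p⊆q∧x∉p⇒p⊆q-x C⊆D r∉C) (λ S C⊆S S⊆D-r → [C,D]⊆F S C⊆S (⊆-trans S⊆D-r (p-x⊆p D (root D)))) D-r≢∅)
    where D∈F = [C,D]⊆F D C⊆D ⊆-refl

  Descent-∈F : ∀ {C D T} → Descent C D T → ∀ {S} → S ⊆ D → (S ⊆ T → S ∈F F) → S ∈F F
  Descent-∈F (bottom _ _ _)    S⊆D below-T = below-T S⊆D
  Descent-∈F (blocked _ _ _ _) S⊆D below-T = below-T S⊆D
  Descent-∈F {D = D} (step D∈F D≢∅ _ _ rest) {S} S⊆D below-T with root D ∈? S
  ... | yes r∈S = proj₂ (root-spec D∈F D≢∅) S (x∈p⇒⁅x⁆⊆p r∈S) S⊆D
  ... | no r∉S  = Descent-∈F rest (p⊆q∧x∉p⇒p⊆q-x S⊆D r∉S) below-T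

  ∈F-below : ∀ {T S} → T ∈F F → Nonempty T → S ⊆ T → root T ∈ₛ S ⊎ Empty (T - root T) → S ∈F F
  ∈F-below {S = S} T∈F T≢∅ S⊆T (inj₁ r∈S) = proj₂ (root-spec T∈F T≢∅) S (x∈p⇒⁅x⁆⊆p r∈S) S⊆T
  ∈F-below {T} {S} T∈F T≢∅ S⊆T (inj₂ T-r≡∅) with root T ∈? S
  ... | yes r∈S = ∈F-below T∈F T≢∅ S⊆T (inj₁ r∈S)
  ... | no r∉S  = subst (_∈F F) (sym (p⊆∅⇒p≡∅ (λ x∈S → ⊥-elim (T-r≡∅ (_ , p⊆q∧x∉p⇒p⊆q-x S⊆T r∉S x∈S))))) ∅∈F

  Descent-interval : ∀ {C D T C″} → Descent C D T → root T ∈ₛ C″ ⊎ Empty (T - root T) → IntervalIn F C″ D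
  Descent-interval d stop S C″⊆S S⊆D =
    let (T∈F , T≢∅) = Descent-end d
    in Descent-∈F d S⊆D (λ S⊆T → ∈F-below T∈F T≢∅ S⊆T (Sum.map₁ C″⊆S stop))

module Matching {n : ℕ} (F : Family n) (rooted : SimplyRooted F) (∅∈F : ∅ ∈F F) (default : Fin n) where

  open Boundary using (Facet; ⊑-refl; ⊑-trans)
  open Collapse
  open Realization
  open SubsetLemmas
  open RootDescent F rooted ∅∈F default
  open import Data.Nat as ℕ using (suc; _∸_; _<_; s≤s)
  import Data.Nat.Properties as ℕ
  open MixedRadix (suc n)
  open import Data.Bool using (true)
  import Data.Bool as Bool
  open import Data.Fin.Subset using (Subset; ⁅_⁆; _⊆_; _∪_; _-_; Nonempty; Empty; ∣_∣) renaming (_∈_ to _∈ₛ_; _∉_ to _∉ₛ_)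
  open import Data.Fin.Subset.Properties using (⊆-refl; ⊆-trans; _∈?_; _⊆?_; nonempty?; ∣p∣≤n; p─q─q≡p─q; x∈p∧x≢y⇒x∈p-y; Empty-unique)
  open import Data.List using (List; map; filter; cartesianProduct)
  open import Data.List.Membership.Propositional using (_∈_)
  open import Data.List.Membership.Propositional.Properties using (∈-map⁺; ∈-map⁻; ∈-filter⁺; ∈-filter⁻; ∈-cartesianProduct⁺)
  import Data.List.Relation.Unary.All as All
  open import Data.Product using (∃; ∃₂; _×_; _,_; proj₁; proj₂; uncurry)
  open import Data.Sum using (_⊎_; inj₁; inj₂; [_,_]′)
  open import Relation.Binary.PropositionalEquality
  open import Relation.Nullary using (Dec; yes; no; ¬?)
  open import Relation.Nullary.Decidable using (_×-dec_; _→-dec_)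
  open import Data.Empty using (⊥-elim)
  open import Function using (_∘_)
  open import Data.Vec.Properties using () renaming (≡-dec to Vec-≡-dec)

  _≟ˢ_ : (C D : Subset n) → Dec (C ≡ D)
  _≟ˢ_ = Vec-≡-dec Bool._≟_

  X-cube : ∀ {Q} → X F Q → ∃₂ λ C D → Q ≡ real C D × C ⊆ D × IntervalIn F C D
  X-cube (A , B , (A⊆B , [A,B]⊆F) , Q⊑) =
    let (C , D , Q≡ , A⊆C , C⊆D , D⊆B) = face-of-real A⊆B Q⊑
    in C , D , Q≡ , C⊆D , λ S C⊆S S⊆D → [A,B]⊆F S (⊆-trans A⊆C C⊆S) (⊆-trans S⊆D D⊆B)

  real∈X : ∀ {C D} → C ⊆ D → IntervalIn F C D → X F (real C D)
  real∈X {C} {D} C⊆D [C,D]⊆F = C , D , (C⊆D , [C,D]⊆F) , ⊑-refl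

  X-face-closed : FaceClosed (X F)
  X-face-closed (A , B , [A,B]∈𝒞 , P⊑) Q⊑P = A , B , [A,B]∈𝒞 , ⊑-trans Q⊑P P⊑

  bottomOf : Subset n → Subset n → Subset n
  bottomOf C D = descend n C D

  descent : ∀ {C D} → C ⊆ D → IntervalIn F C D → Nonempty D → Descent C D (bottomOf C D)
  descent {D = D} = descend-sound n (∣p∣≤n D)

  pivotOf : Subset n → Subset n → Fin n
  pivotOf C D = pivot (bottomOf C D)

  -- lexicographic: a coface of a lower cube has a larger D, or the same D and a smaller descent end, or else a smaller C - pivot
  rankOf : Subset n → Subset n → ℕ
  rankOf C D = encode (n ∸ ∣ D ∣) (∣ bottomOf C D ∣) (∣ C - pivotOf C D ∣)

  pairOf : Subset n → Subset n → RankedPair n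
  pairOf C D = rankedPair (real (C ∪ ⁅ pivotOf C D ⁆) D) (real C D) (rankOf C D)

  UpperCell : Subset n → Subset n → Set
  UpperCell C D = C ⊆ D × IntervalIn F C D × Nonempty D × pivotOf C D ∉ₛ C

  upperCell? : ∀ C D → Dec (UpperCell C D)
  upperCell? C D = C ⊆? D ×-dec interval? ×-dec nonempty? D ×-dec ¬? (pivotOf C D ∈? C)
    where
    interval? : Dec (IntervalIn F C D)
    interval? with All.all? (λ S → C ⊆? S →-dec S ⊆? D →-dec F S Bool.≟ true) (allSubsets n)
    ... | yes all-in-F = yes λ S → All.lookup all-in-F (∈-allSubsets S)
    ... | no ¬all-in-F = no λ [C,D]⊆F → ¬all-in-F (All.tabulate λ {S} _ → [C,D]⊆F S)

  intervals : List (Subset n × Subset n)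
  intervals = cartesianProduct (allSubsets n) (allSubsets n)

  pairs : List (RankedPair n)
  pairs = map (uncurry pairOf) (filter (uncurry upperCell?) intervals)

  pairOf∈pairs : ∀ {C D} → UpperCell C D → pairOf C D ∈ pairs
  pairOf∈pairs {C} {D} upper =
    ∈-map⁺ (uncurry pairOf) (∈-filter⁺ (uncurry upperCell?) (∈-cartesianProduct⁺ (∈-allSubsets C) (∈-allSubsets D)) upper)

  ∈pairs⁻ : ∀ {p} → p ∈ pairs → ∃₂ λ C D → UpperCell C D × p ≡ pairOf C D
  ∈pairs⁻ p∈pairs =
    let ((C , D) , CD∈ , p≡) = ∈-map⁻ (uncurry pairOf) p∈pairs
    in C , D , proj₂ (∈-filter⁻ (uncurry upperCell?) {xs = intervals} CD∈) , p≡

  private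
    ∣p∣<1+n : ∀ (S : Subset n) → ∣ S ∣ < suc n
    ∣p∣<1+n S = s≤s (∣p∣≤n S)

    pivot∪⊆ : ∀ {C D} → C ⊆ D → IntervalIn F C D → Nonempty D → C ∪ ⁅ pivotOf C D ⁆ ⊆ D
    pivot∪⊆ C⊆D [C,D]⊆F D≢∅ x∈ with x∈p∪⁅y⁆⁻ x∈
    ... | inj₁ x∈C = C⊆D x∈C
    ... | inj₂ refl = let d = descent C⊆D [C,D]⊆F D≢∅ in Descent-⊆ d (Descent-pivot∈ d)

    interval-shrink : ∀ {C C′ D} → C ⊆ C′ → IntervalIn F C D → IntervalIn F C′ D
    interval-shrink C⊆C′ [C,D]⊆F S C′⊆S = [C,D]⊆F S (⊆-trans C⊆C′ C′⊆S)

  matched : ∀ {C D} → C ⊆ D → IntervalIn F C D → Nonempty D → ∃ λ p → p ∈ pairs × real C D ∈ᴾ p × rank p ≡ rankOf C D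
  matched {C} {D} C⊆D [C,D]⊆F D≢∅ with pivotOf C D ∈? C
  ... | no j∉C  = pairOf C D , pairOf∈pairs (C⊆D , [C,D]⊆F , D≢∅ , j∉C) , inj₂ refl , refl
  ... | yes j∈C = pairOf C′ D , pairOf∈pairs (C′⊆D , [C′,D]⊆F , D≢∅ , j′∉C′) , inj₁ real≡ , rank≡
    where
    open ≡-Reasoning
    j = pivotOf C D
    T = bottomOf C D
    d = descent C⊆D [C,D]⊆F D≢∅
    -- the pivot is never a root met by the descent, so deleting it from C leaves the descent unchanged
    C′ = C - j
    C′⊆D = ⊆-trans (p-x⊆p C j) C⊆D
    d′ : Descent C′ D T
    d′ = Descent-toggle-pivot d (λ _ x∈C′ → proj₁ (x∈p-y⁻ x∈C′)) (λ x≢j x∈C → x∈p∧x≢y⇒x∈p-y x∈C x≢j)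
    [C′,D]⊆F : IntervalIn F C′ D
    [C′,D]⊆F = Descent-interval d′ (stop′ (Descent-stop d))
      where
      stop′ : Empty (T - root T) ⊎ (Nonempty (T - root T) × root T ∈ₛ C) → root T ∈ₛ C′ ⊎ Empty (T - root T)
      stop′ (inj₁ T-r≡∅)         = inj₂ T-r≡∅
      stop′ (inj₂ (T-r≢∅ , r∈C)) = inj₁ (x∈p∧x≢y⇒x∈p-y r∈C (pivot≢root T-r≢∅ ∘ sym))
    bottom≡ : bottomOf C′ D ≡ T
    bottom≡ = Descent-deterministic (descent C′⊆D [C′,D]⊆F D≢∅) d′
    pivot≡ : pivotOf C′ D ≡ j
    pivot≡ = cong pivot bottom≡
    j′∉C′ : pivotOf C′ D ∉ₛ C′
    j′∉C′ = subst (_∉ₛ C′) (sym pivot≡) (x∉p-x C j)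
    real≡ : real C D ≡ real (C′ ∪ ⁅ pivotOf C′ D ⁆) D
    real≡ = cong (λ S → real S D) (sym (trans (cong (λ k → C′ ∪ ⁅ k ⁆) pivot≡) (x∈p⇒p-x∪⁅x⁆≡p j∈C)))
    rank≡ : rankOf C′ D ≡ rankOf C D
    rank≡ = begin
      encode (n ∸ ∣ D ∣) (∣ bottomOf C′ D ∣) (∣ C′ - pivotOf C′ D ∣) ≡⟨ cong₂ (λ S k → encode (n ∸ ∣ D ∣) (∣ S ∣) (∣ C′ - k ∣)) bottom≡ pivot≡ ⟩
      encode (n ∸ ∣ D ∣) (∣ T ∣) (∣ C - j - j ∣)                   ≡⟨ cong (λ S → encode (n ∸ ∣ D ∣) (∣ T ∣) (∣ S ∣)) (p─q─q≡p─q C ⁅ j ⁆) ⟩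
      encode (n ∸ ∣ D ∣) (∣ T ∣) (∣ C - j ∣)                       ∎

  coface-rank< : ∀ {C D C′ D′} → UpperCell C D → C′ ⊆ D′ → IntervalIn F C′ D′ → C′ ⊆ C ∪ ⁅ pivotOf C D ⁆ → D ⊆ D′ →
    real C′ D′ ≢ real (C ∪ ⁅ pivotOf C D ⁆) D → real C′ D′ ≢ real C D → rankOf C′ D′ < rankOf C D
  coface-rank< {C} {D} {C′} {D′} (C⊆D , [C,D]⊆F , D≢∅ , j∉C) C′⊆D′ [C′,D′]⊆F C′⊆C∪j D⊆D′ ≢lower ≢upper
    with D′ ≟ˢ D
  ... | no D′≢D = encode-<₁ (ℕ.∸-monoʳ-< (p⊆q∧p≢q⇒∣p∣<∣q∣ D⊆D′ (D′≢D ∘ sym)) (∣p∣≤n D′)) (∣p∣<1+n (bottomOf C′ D′)) (∣p∣<1+n (C′ - pivotOf C′ D′))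
  ... | yes refl with Descent-shrinks (descent C⊆D [C,D]⊆F D≢∅) C′⊆C∪j (descent C′⊆D′ [C′,D′]⊆F D≢∅)
  ...   | inj₁ ∣T′∣<∣T∣ = encode-<₂ (n ∸ ∣ D ∣) ∣T′∣<∣T∣ (∣p∣<1+n (C′ - pivotOf C′ D))
  ...   | inj₂ T′≡T = begin-strict
    encode (n ∸ ∣ D ∣) (∣ bottomOf C′ D ∣) (∣ C′ - pivotOf C′ D ∣) ≡⟨ cong (λ T → encode (n ∸ ∣ D ∣) (∣ T ∣) (∣ C′ - pivot T ∣)) T′≡T ⟩
    encode (n ∸ ∣ D ∣) (∣ T ∣) (∣ C′ - j ∣)                       <⟨ encode-<₃ (n ∸ ∣ D ∣) (∣ T ∣) ∣C′-j∣<∣C∣ ⟩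
    encode (n ∸ ∣ D ∣) (∣ T ∣) (∣ C ∣)                            ≡⟨ cong (λ S → encode (n ∸ ∣ D ∣) (∣ T ∣) (∣ S ∣)) (sym (x∉p⇒p-x≡p j∉C)) ⟩
    encode (n ∸ ∣ D ∣) (∣ T ∣) (∣ C - j ∣)                        ∎
    where
    open ℕ.≤-Reasoning
    T = bottomOf C D
    j = pivotOf C D
    ∣C′-j∣<∣C∣ : ∣ C′ - j ∣ < ∣ C ∣
    ∣C′-j∣<∣C∣ = p⊆q∪⁅x⁆⇒∣p-x∣<∣q∣ C′⊆C∪j j∉C (≢lower ∘ cong (λ S → real S D)) (≢upper ∘ cong (λ S → real S D))

  pairs-facet : ∀ {p} → p ∈ pairs → X F (lower p) × X F (upper p) × Facet (lower p) (upper p)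
  pairs-facet p∈pairs with ∈pairs⁻ p∈pairs
  ... | C , D , (C⊆D , [C,D]⊆F , D≢∅ , j∉C) , refl =
    real∈X (pivot∪⊆ C⊆D [C,D]⊆F D≢∅) (interval-shrink p⊆p∪⁅x⁆ [C,D]⊆F) ,
    real∈X C⊆D [C,D]⊆F ,
    real-facet (pivot∪⊆ C⊆D [C,D]⊆F D≢∅ (x∈p∪⁅y⁆⁺ (inj₂ refl))) j∉C

  pairs-coface-lower : ∀ {p} → p ∈ pairs → ∀ {P} → X F P → lower p ⊑ P → P ≢ lower p → P ≢ upper p →
    ∃ λ q → q ∈ pairs × P ∈ᴾ q × rank q < rank p
  pairs-coface-lower p∈pairs XP lower⊑P P≢lower P≢upper with ∈pairs⁻ p∈pairs | X-cube XP
  ... | C , D , upper@(C⊆D , [C,D]⊆F , D≢∅ , _) , refl | C′ , D′ , refl , C′⊆D′ , [C′,D′]⊆F =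
    let (C′⊆C∪j , D⊆D′) = real-⊑-real (pivot∪⊆ C⊆D [C,D]⊆F D≢∅) C′⊆D′ lower⊑P
        (q , q∈pairs , P∈q , rank≡) = matched C′⊆D′ [C′,D′]⊆F (Nonempty-mono D⊆D′ D≢∅)
    in q , q∈pairs , P∈q , subst (_< rankOf C D) (sym rank≡) (coface-rank< upper C′⊆D′ [C′,D′]⊆F C′⊆C∪j D⊆D′ P≢lower P≢upper)

  pair-cell : ∀ {C D Q} → UpperCell C D → Q ∈ᴾ pairOf C D →
    ∃ λ E → Q ≡ real E D × E ⊆ D × E - pivot (bottomOf E D) ≡ C
  pair-cell {C} {D} (C⊆D , [C,D]⊆F , D≢∅ , j∉C) (inj₁ refl) =
    C ∪ ⁅ j ⁆ , refl , C∪j⊆D , trans (cong (λ T → (C ∪ ⁅ j ⁆) - pivot T) bottom≡) (x∉p⇒p∪⁅x⁆-x≡p j∉C)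
    where
    j = pivotOf C D
    C∪j⊆D = pivot∪⊆ C⊆D [C,D]⊆F D≢∅
    toggled : Descent (C ∪ ⁅ j ⁆) D (bottomOf C D)
    toggled = Descent-toggle-pivot (descent C⊆D [C,D]⊆F D≢∅) (λ x≢j x∈ → [ (λ x∈C → x∈C) , ⊥-elim ∘ x≢j ]′ (x∈p∪⁅y⁆⁻ x∈)) (λ _ → p⊆p∪⁅x⁆)
    bottom≡ : bottomOf (C ∪ ⁅ j ⁆) D ≡ bottomOf C D
    bottom≡ = Descent-deterministic (descent C∪j⊆D (interval-shrink p⊆p∪⁅x⁆ [C,D]⊆F) D≢∅) toggled
  pair-cell (C⊆D , _ , _ , j∉C) (inj₂ refl) = _ , refl , C⊆D , x∉p⇒p-x≡p j∉C

  pairs-disjoint : ∀ {p q} → p ∈ pairs → q ∈ pairs → ∀ {Q} → Q ∈ᴾ p → Q ∈ᴾ q → p ≡ q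
  pairs-disjoint p∈pairs q∈pairs Q∈p Q∈q with ∈pairs⁻ p∈pairs | ∈pairs⁻ q∈pairs
  ... | C , D , upper , refl | C′ , D′ , upper′ , refl with pair-cell upper Q∈p | pair-cell upper′ Q∈q
  ... | E , Q≡ , E⊆D , E-j≡C | E′ , Q≡′ , E′⊆D′ , E′-j≡C′ with real-injective E⊆D E′⊆D′ (trans (sym Q≡) Q≡′)
  ... | refl , refl = cong (λ S → pairOf S D) (trans (sym E-j≡C) E′-j≡C′)

  pairs-matching : IsRankedMatching (X F) pairs
  pairs-matching = record
    { facet-pair   = pairs-facet
    ; coface-lower = pairs-coface-lower
    ; disjoint     = pairs-disjoint
    }

  origin : Cube n
  origin = real ∅ ∅

  dim-origin : dim origin ≡ 0
  dim-origin = dim-real-∅ {n}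

  origin∈X : X F origin
  origin∈X = real∈X ⊆-refl (λ S _ S⊆∅ → subst (_∈F F) (sym (p⊆∅⇒p≡∅ S⊆∅)) ∅∈F)

  unmatched-origin : ∀ {Q} → Unmatched (X F) pairs Q → Q ≡ origin
  unmatched-origin (XQ , unmatched) with X-cube XQ
  ... | C , D , refl , C⊆D , [C,D]⊆F with nonempty? D
  ...   | yes D≢∅ = let (p , p∈pairs , Q∈p , _) = matched C⊆D [C,D]⊆F D≢∅ in ⊥-elim (unmatched p∈pairs Q∈p)
  ...   | no D≡∅ with Empty-unique D≡∅
  ...     | refl = cong (λ S → real S ∅) (p⊆∅⇒p≡∅ C⊆D)

theorem1p2 : (n : ℕ) → 1 ≤ n → (𝓕 : Family n) → SimplyRooted 𝓕 → ∅ ∈F 𝓕 → Acyclic (X 𝓕)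
theorem1p2 zero    ()
theorem1p2 (suc m) _ 𝓕 rooted ∅∈𝓕 =
  (origin , origin∈X) ,
  acyclicOrEmpty-by-matching X-face-closed pairs-matching
    (point-acyclicOrEmpty origin dim-origin unmatched-origin)
  where
  open Collapse using (acyclicOrEmpty-by-matching; point-acyclicOrEmpty)
  open Matching 𝓕 rooted ∅∈𝓕 zero
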